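{- Let $0<\alpha<\frac14$. Then there exists a set $A\subset\mathbb{N}$ having Buck density $\mu(A)=\alpha$ and such that $\underline{\mu}(A+A)\le\frac12<\overline{\mu}(A+A)$.
   Context: $\mathbb{N}=\{0,1,2,\dots\}$; $A+A$ is the sumset. Let $\mathcal{Z}$ be the family of all finite unions $\bigcup_{i=1}^r(a_i+k_i\mathbb{N})$ with $r,a_i,k_i\in\mathbb{N}$; each $B\in\mathcal{Z}$ has natural density $d(B)=\lim_{n\to\infty}|B\cap[1,n]|/n$. For $X\subset\mathbb{N}$: upper Buck density $\overline{\mu}(X)=\inf\{d(B):X\subset B\in\mathcal{Z}\}$, lower Buck density $\underline{\mu}(X)=\sup\{d(B):X\supset B\in\mathcal{Z}\}$; if they coincide $X$ has Buck density $\mu(X)$ equal to the common value. -}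

module Defs where

open import Data.Nat as ℕ using (ℕ; zero; suc; _≤ᵇ_; _≡ᵇ_; _%_)
open import Data.Bool using (Bool; true; false; _∧_; _∨_; if_then_else_)
open import Data.List using (List; []; _∷_)
open import Data.Product using (Σ; _×_; _,_; ∃; ∃-syntax)
open import Data.Integer using (+_)
open import Data.Rational using (ℚ; _/_; _+_; _-_; ∣_∣; _≤_; _<_)
open import Relation.Binary.PropositionalEquality using (_≡_)

Subset : Set₁
Subset = ℕ → Set

_⊕_ : Subset → Subset → Subset
(A ⊕ B) n = Σ ℕ λ a → Σ ℕ λ b → A a × B b × (a ℕ.+ b ≡ n)

-- Members of the family 𝒵: a finite union ⋃ (a_i + k_i ℕ), given by the
-- list of pairs (a_i , k_i).  (r = length of the list; r = 0 allowed.)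
Code : Set
Code = List (ℕ × ℕ)

-- n ∈ a + kℕ  (k = 0 gives the singleton {a})
inAP : ℕ → ℕ → ℕ → Bool
inAP a zero    n = n ≡ᵇ a
inAP a (suc k) n = (a ≤ᵇ n) ∧ (((n ℕ.∸ a) % suc k) ≡ᵇ 0)

memb : Code → ℕ → Bool
memb []             n = false
memb ((a , k) ∷ L)  n = inAP a k n ∨ memb L n

⟦_⟧ : Code → Subset
⟦ L ⟧ n = memb L n ≡ true

_⊆_ : Subset → Subset → Set
X ⊆ Y = ∀ n → X n → Y n

-- |B ∩ [1,n]|
count : Code → ℕ → ℕ
count L zero    = 0
count L (suc n) = (if memb L (suc n) then 1 else 0) ℕ.+ count L n

inv : ℕ → ℚ
inv j = + 1 / suc j

HasDensity : Code → ℚ → Set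
HasDensity L q = ∀ j → ∃[ N ] ∀ m → N ℕ.≤ m →
  ∣ (+ count L (suc m)) / suc m - q ∣ ≤ inv j

-- Constructive (Bishop) real numbers: regular Cauchy sequences of
-- rationals, |x m - x n| ≤ 1/(m+1) + 1/(n+1).
record ℝ : Set where
  field
    seq : ℕ → ℚ
    reg : ∀ m n → ∣ seq m - seq n ∣ ≤ inv m + inv n
open ℝ public

_≤ʳq_ : ℝ → ℚ → Set
x ≤ʳq q = ∀ n → seq x n ≤ q + inv n

_q≤ʳ_ : ℚ → ℝ → Set
q q≤ʳ x = ∀ n → q ≤ seq x n + inv n

_<ʳq_ : ℝ → ℚ → Set
x <ʳq q = ∃[ n ] (seq x n + inv n < q)

_q<ʳ_ : ℚ → ℝ → Set
q q<ʳ x = ∃[ n ] (q < seq x n - inv n)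

-- upper Buck density μ̄(X) = α  (α is the infimum of d(B), X ⊆ B ∈ 𝒵)
UpperBuck= : Subset → ℝ → Set
UpperBuck= X α =
  (∀ L q → X ⊆ ⟦ L ⟧ → HasDensity L q → α ≤ʳq q) ×
  (∀ q → α <ʳq q → ∃[ L ] ∃[ q' ] (X ⊆ ⟦ L ⟧ × HasDensity L q' × q' < q))

-- lower Buck density μ̲(X) = α  (α is the supremum of d(B), X ⊇ B ∈ 𝒵)
LowerBuck= : Subset → ℝ → Set
LowerBuck= X α =
  (∀ L q → ⟦ L ⟧ ⊆ X → HasDensity L q → q q≤ʳ α) ×
  (∀ q → q q<ʳ α → ∃[ L ] ∃[ q' ] (⟦ L ⟧ ⊆ X × HasDensity L q' × q < q'))

BuckDensity= : Subset → ℝ → Set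
BuckDensity= X α = UpperBuck= X α × LowerBuck= X α

LowerBuck≤ : Subset → ℚ → Set
LowerBuck≤ X r = ∀ L q → ⟦ L ⟧ ⊆ X → HasDensity L q → q ≤ r

UpperBuck> : Subset → ℚ → Set
UpperBuck> X r = ∃[ s ] (r < s × (∀ L q → X ⊆ ⟦ L ⟧ → HasDensity L q → s ≤ q))

-- A is the union of A₀ = 4·{y : the van der Corput point of y lies below 4α} and a sparse set P
-- living in blocks [B_K, B_K + M_K) that are separated by huge gaps.  Periodic patterns of
-- dyadic intervals approximate A₀ from inside and outside with densities tending to α, and P is
-- covered by periodic sets of density at most 2^-K, so μ(A) = α.  Modulo 4, A₀ ⊆ 4ℕ and
-- P ⊆ {0,1} + 4ℕ, so sums ≡ 2, 3 (mod 4) in A + A come from P + P.  By the gaps, P + P contains no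
-- infinite arithmetic progression; hence every B ∈ 𝒵 inside A + A eventually lies in {0,1} + 4ℕ
-- and μ̲(A + A) ≤ 1/2.  On the other hand the digit sets defining P are additive bases, so P + P
-- meets every residue class modulo M_K that is not ≡ 3 (mod 4); hence every B ∈ 𝒵 containing
-- A + A contains all large n ≢ 3 (mod 4), and μ̄(A + A) ≥ 3/4.

module Submission where

open import Defs
open import Data.Bool using (Bool; true; false; _∧_; _∨_; if_then_else_; T)
import Data.Bool.Properties as Boolₚ
open import Data.Empty using (⊥-elim)
import Data.Integer as ℤ
import Data.Integer.Properties as ℤₚ
open import Data.List using ([]; _∷_; _++_)
import Data.Nat as ℕ
open import Data.Nat using (ℕ; zero; suc; z≤n; s≤s)
import Data.Nat.Properties as ℕₚ
import Data.Rational as ℚ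
open import Data.Rational using (mkℚ; _/_; 0ℚ; ½)
import Data.Rational.Properties as ℚₚ
import Data.Rational.Unnormalised as ℚᵘ
import Data.Rational.Unnormalised.Properties as ℚᵘₚ
open import Data.Product using (Σ; ∃-syntax; _×_; _,_; proj₁; proj₂)
open import Data.Sum using (_⊎_; inj₁; inj₂)
open import Relation.Binary.PropositionalEquality
open import Relation.Nullary using (¬_; Dec; yes; no)
open import Function.Bundles using (Equivalence)

module Fractions where
  open ℚ using (_+_; _-_; -_; ∣_∣; _≤_; _<_)
  open import Data.Integer using (+_; +[1+_]; -[1+_])
  open import Data.Rational.Solver using (module +-*-Solver)
  open +-*-Solver using (solve; _:+_; _:-_; :-_; _:=_)
  open import Data.Nat.Tactic.RingSolver using () renaming (solve-∀ to solve-∀ₙ)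

  toℚᵘ-/ : ∀ a n → ℚ.toℚᵘ (+ a / suc n) ℚᵘ.≃ ℚᵘ.mkℚᵘ (+ a) n
  toℚᵘ-/ a n = ℚₚ.toℚᵘ-fromℚᵘ (ℚᵘ.mkℚᵘ (+ a) n)

  frac-≤ : ∀ a b n m → a ℕ.* suc m ℕ.≤ b ℕ.* suc n → + a / suc n ≤ + b / suc m
  frac-≤ a b n m h = ℚₚ.toℚᵘ-cancel-≤
    (ℚᵘₚ.≤-respˡ-≃ (ℚᵘₚ.≃-sym (toℚᵘ-/ a n)) (ℚᵘₚ.≤-respʳ-≃ (ℚᵘₚ.≃-sym (toℚᵘ-/ b m))
      (ℚᵘ.*≤* (subst₂ ℤ._≤_ (ℤₚ.pos-* a (suc m)) (ℤₚ.pos-* b (suc n)) (ℤ.+≤+ h)))))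

  frac-< : ∀ a b n m → a ℕ.* suc m ℕ.< b ℕ.* suc n → + a / suc n < + b / suc m
  frac-< a b n m h = ℚₚ.toℚᵘ-cancel-<
    (ℚᵘₚ.<-respˡ-≃ (ℚᵘₚ.≃-sym (toℚᵘ-/ a n)) (ℚᵘₚ.<-respʳ-≃ (ℚᵘₚ.≃-sym (toℚᵘ-/ b m))
      (ℚᵘ.*<* (subst₂ ℤ._<_ (ℤₚ.pos-* a (suc m)) (ℤₚ.pos-* b (suc n)) (ℤ.+<+ h)))))

  frac-<⁻¹ : ∀ a b n m → + a / suc n < + b / suc m → a ℕ.* suc m ℕ.< b ℕ.* suc n
  frac-<⁻¹ a b n m h with a ℕ.* suc m ℕₚ.<? b ℕ.* suc n
  ... | yes lt = lt
  ... | no ≮ = ⊥-elim (ℚₚ.<-irrefl refl (ℚₚ.<-≤-trans h (frac-≤ b a m n (ℕₚ.≮⇒≥ ≮))))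

  private
    toℚᵘ-/+/ : ∀ a b n m → ℚ.toℚᵘ (+ a / suc n + + b / suc m) ℚᵘ.≃ ℚᵘ.mkℚᵘ (+ a) n ℚᵘ.+ ℚᵘ.mkℚᵘ (+ b) m
    toℚᵘ-/+/ a b n m =
      ℚᵘₚ.≃-trans (ℚₚ.toℚᵘ-homo-+ (+ a / suc n) (+ b / suc m)) (ℚᵘₚ.+-cong (toℚᵘ-/ a n) (toℚᵘ-/ b m))

    numerator-+ : ∀ a b c n m → + ((a ℕ.* suc m ℕ.+ b ℕ.* suc n) ℕ.* c) ≡ (+ a ℤ.* + suc m ℤ.+ + b ℤ.* + suc n) ℤ.* + c
    numerator-+ a b c n m = trans (ℤₚ.pos-* (a ℕ.* suc m ℕ.+ b ℕ.* suc n) c) (cong (ℤ._* + c)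
      (trans (ℤₚ.pos-+ (a ℕ.* suc m) (b ℕ.* suc n)) (cong₂ ℤ._+_ (ℤₚ.pos-* a (suc m)) (ℤₚ.pos-* b (suc n)))))

  frac-≤-+ : ∀ a b c n m k → c ℕ.* (suc n ℕ.* suc m) ℕ.≤ (a ℕ.* suc m ℕ.+ b ℕ.* suc n) ℕ.* suc k →
    + c / suc k ≤ + a / suc n + + b / suc m
  frac-≤-+ a b c n m k h = ℚₚ.toℚᵘ-cancel-≤
    (ℚᵘₚ.≤-respˡ-≃ (ℚᵘₚ.≃-sym (toℚᵘ-/ c k)) (ℚᵘₚ.≤-respʳ-≃ (ℚᵘₚ.≃-sym (toℚᵘ-/+/ a b n m))
      (ℚᵘ.*≤* (subst₂ ℤ._≤_ (ℤₚ.pos-* c (suc n ℕ.* suc m)) (numerator-+ a b (suc k) n m) (ℤ.+≤+ h)))))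

  frac-+-≤ : ∀ a b c n m k → (a ℕ.* suc m ℕ.+ b ℕ.* suc n) ℕ.* suc k ℕ.≤ c ℕ.* (suc n ℕ.* suc m) →
    + a / suc n + + b / suc m ≤ + c / suc k
  frac-+-≤ a b c n m k h = ℚₚ.toℚᵘ-cancel-≤
    (ℚᵘₚ.≤-respʳ-≃ (ℚᵘₚ.≃-sym (toℚᵘ-/ c k)) (ℚᵘₚ.≤-respˡ-≃ (ℚᵘₚ.≃-sym (toℚᵘ-/+/ a b n m))
      (ℚᵘ.*≤* (subst₂ ℤ._≤_ (numerator-+ a b (suc k) n m) (ℤₚ.pos-* c (suc n ℕ.* suc m)) (ℤ.+≤+ h)))))

  frac-≤-+inv : ∀ a b n m E j → a ℕ.* suc m ℕ.≤ b ℕ.* suc n ℕ.+ E → E ℕ.* suc j ℕ.≤ suc n ℕ.* suc m →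
    + a / suc n ≤ + b / suc m + inv j
  frac-≤-+inv a b n m E j a≤b+E E≤nm =
    ℚₚ.≤-trans (frac-≤ a c n (j ℕ.+ m ℕ.* suc j) (subst₂ ℕ._≤_ (reassoc a m j) (expand b n m j) cross))
               (frac-≤-+ b 1 c m j (j ℕ.+ m ℕ.* suc j) ℕₚ.≤-refl)
    where
    c = b ℕ.* suc j ℕ.+ 1 ℕ.* suc m
    cross : a ℕ.* suc m ℕ.* suc j ℕ.≤ b ℕ.* suc n ℕ.* suc j ℕ.+ suc n ℕ.* suc m
    cross = ℕₚ.≤-trans (ℕₚ.*-monoˡ-≤ (suc j) a≤b+E)
      (ℕₚ.≤-trans (ℕₚ.≤-reflexive (ℕₚ.*-distribʳ-+ (suc j) (b ℕ.* suc n) E)) (ℕₚ.+-monoʳ-≤ (b ℕ.* suc n ℕ.* suc j) E≤nm))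
    reassoc : ∀ a m j → a ℕ.* suc m ℕ.* suc j ≡ a ℕ.* (suc m ℕ.* suc j)
    reassoc = solve-∀ₙ
    expand : ∀ b n m j → b ℕ.* suc n ℕ.* suc j ℕ.+ suc n ℕ.* suc m ≡ (b ℕ.* suc j ℕ.+ 1 ℕ.* suc m) ℕ.* suc n
    expand = solve-∀ₙ

  inv-nonneg : ∀ j → 0ℚ ≤ inv j
  inv-nonneg j = frac-≤ 0 1 0 j z≤n

  p≤∣p∣ : ∀ p → p ≤ ∣ p ∣
  p≤∣p∣ p with ℚₚ.∣p∣≡p∨∣p∣≡-p p
  ... | inj₁ ∣p∣≡p = ℚₚ.≤-reflexive (sym ∣p∣≡p)
  ... | inj₂ ∣p∣≡-p = ℚₚ.≤-trans p≤0 (ℚₚ.0≤∣p∣ p)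
    where
    p≤0 : p ≤ 0ℚ
    p≤0 = subst (_≤ 0ℚ) (solve 1 (λ p → :- (:- p) := p) refl p)
            (ℚₚ.neg-antimono-≤ (subst (0ℚ ≤_) ∣p∣≡-p (ℚₚ.0≤∣p∣ p)))

  -p≤∣p∣ : ∀ p → - p ≤ ∣ p ∣
  -p≤∣p∣ p = subst (- p ≤_) (ℚₚ.∣-p∣≡∣p∣ p) (p≤∣p∣ (- p))

  ∣p-q∣≤r⇒p≤q+r : ∀ p q r → ∣ p - q ∣ ≤ r → p ≤ q + r
  ∣p-q∣≤r⇒p≤q+r p q r h = subst₂ _≤_
    (solve 2 (λ p q → (p :- q) :+ q := p) refl p q) (ℚₚ.+-comm r q)
    (ℚₚ.+-monoˡ-≤ q (ℚₚ.≤-trans (p≤∣p∣ (p - q)) h))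

  ∣p-q∣≤r⇒q≤p+r : ∀ p q r → ∣ p - q ∣ ≤ r → q ≤ p + r
  ∣p-q∣≤r⇒q≤p+r p q r h = subst₂ _≤_
    (solve 2 (λ p q → (:- (p :- q)) :+ p := q) refl p q) (ℚₚ.+-comm r p)
    (ℚₚ.+-monoˡ-≤ p (ℚₚ.≤-trans (-p≤∣p∣ (p - q)) h))

  p≤q+r∧q≤p+r⇒∣p-q∣≤r : ∀ p q r → p ≤ q + r → q ≤ p + r → ∣ p - q ∣ ≤ r
  p≤q+r∧q≤p+r⇒∣p-q∣≤r p q r p≤ q≤ with ℚₚ.∣p∣≡p∨∣p∣≡-p (p - q)
  ... | inj₁ eq rewrite eq = subst (p - q ≤_)
    (solve 2 (λ q r → (q :+ r) :- q := r) refl q r) (ℚₚ.+-monoˡ-≤ (- q) p≤)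
  ... | inj₂ eq rewrite eq = subst₂ _≤_
    (solve 2 (λ p q → q :- p := :- (p :- q)) refl p q) (solve 2 (λ p r → (p :+ r) :- p := r) refl p r)
    (ℚₚ.+-monoˡ-≤ (- p) q≤)

  inv<pos : ∀ d → 0ℚ < d → ∃[ j ] inv j < d
  inv<pos d@(mkℚ +[1+ n ] d-1 _) _ = suc d-1 , subst (inv (suc d-1) <_) (ℚₚ.↥p/↧p≡p d)
    (frac-< 1 (suc n) (suc d-1) d-1 (ℕₚ.≤-trans (ℕₚ.≤-reflexive (cong suc (ℕₚ.*-identityˡ (suc d-1))))
      (ℕₚ.m≤m+n (suc (suc d-1)) (n ℕ.* suc (suc d-1)))))
  inv<pos (mkℚ (+ zero) _ _) h with ℚₚ.drop-*<* h
  ... | ℤ.+<+ ()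
  inv<pos (mkℚ -[1+ n ] _ _) h with ℚₚ.drop-*<* h
  ... | ()

  ≤-by-inv : ∀ p q → (∀ j → p ≤ q + inv j) → p ≤ q
  ≤-by-inv p q h with p ℚₚ.≤? q
  ... | yes p≤q = p≤q
  ... | no p≰q = ⊥-elim (ℚₚ.<-irrefl refl (ℚₚ.≤-<-trans (h j) q+inv<p))
    where
    0<p-q : 0ℚ < p - q
    0<p-q = subst (_< p - q) (ℚₚ.+-inverseʳ q) (ℚₚ.+-monoˡ-< (- q) (ℚₚ.≰⇒> p≰q))
    j = proj₁ (inv<pos (p - q) 0<p-q)
    q+inv<p : q + inv j < p
    q+inv<p = subst (q + inv j <_) (solve 2 (λ p q → q :+ (p :- q) := p) refl p q)
      (ℚₚ.+-monoʳ-< q (proj₂ (inv<pos (p - q) 0<p-q)))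

  third : ℕ → ℕ
  third j = 2 ℕ.+ 3 ℕ.* j

  inv-third : ∀ j → (inv (third j) + inv (third j)) + inv (third j) ≤ inv j
  inv-third j = ℚₚ.≤-trans (ℚₚ.+-monoˡ-≤ (inv k) (frac-+-≤ 1 1 2 k k k (ℕₚ.≤-reflexive (twice k))))
    (ℚₚ.≤-trans (frac-+-≤ 2 1 3 k k k (ℕₚ.≤-reflexive (thrice k))) (frac-≤ 3 1 k j (ℕₚ.≤-reflexive (thirds j))))
    where
    k = third j
    twice : ∀ k → (1 ℕ.* suc k ℕ.+ 1 ℕ.* suc k) ℕ.* suc k ≡ 2 ℕ.* (suc k ℕ.* suc k)
    twice = solve-∀ₙ
    thrice : ∀ k → (2 ℕ.* suc k ℕ.+ 1 ℕ.* suc k) ℕ.* suc k ≡ 3 ℕ.* (suc k ℕ.* suc k)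
    thrice = solve-∀ₙ
    thirds : ∀ j → 3 ℕ.* suc j ≡ 1 ℕ.* suc (suc (suc (3 ℕ.* j)))
    thirds = solve-∀ₙ

module Counting where
  open import Data.Nat using (_+_; _*_; _≤_; _<_; _%_)
  open import Data.Nat.DivMod using (m≡m%n+[m/n]*n; m%n<n; [m+kn]%n≡m%n; m<n⇒m%n≡m; m<n⇒m/n≡0;
    m*n/n≡m; +-distrib-/-∣ʳ)
  open import Data.Nat.Divisibility using (n∣m*n)
  open import Data.Nat.Tactic.RingSolver using (solve-∀)

  T⇒≡true : ∀ {b} → T b → b ≡ true
  T⇒≡true {true} _ = refl

  ≡true⇒T : ∀ {b} → b ≡ true → T b
  ≡true⇒T refl = _

  ≡ᵇ-true : ∀ {x y} → x ≡ y → (x ℕ.≡ᵇ y) ≡ true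
  ≡ᵇ-true {x} {y} x≡y = T⇒≡true (ℕₚ.≡⇒≡ᵇ x y x≡y)

  ≡ᵇ-false : ∀ {x y} → x ≢ y → (x ℕ.≡ᵇ y) ≡ false
  ≡ᵇ-false {x} {y} x≢y with x ℕ.≡ᵇ y in eq
  ... | true = ⊥-elim (x≢y (ℕₚ.≡ᵇ⇒≡ x y (≡true⇒T eq)))
  ... | false = refl

  ≤ᵇ-true : ∀ {x y} → x ≤ y → (x ℕ.≤ᵇ y) ≡ true
  ≤ᵇ-true x≤y = T⇒≡true (ℕₚ.≤⇒≤ᵇ x≤y)

  ≤ᵇ-false : ∀ {x y} → ¬ x ≤ y → (x ℕ.≤ᵇ y) ≡ false
  ≤ᵇ-false {x} {y} x≰y with x ℕ.≤ᵇ y in eq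
  ... | true = ⊥-elim (x≰y (ℕₚ.≤ᵇ⇒≤ x y (≡true⇒T eq)))
  ... | false = refl

  <ᵇ-true : ∀ {x y} → x < y → (x ℕ.<ᵇ y) ≡ true
  <ᵇ-true x<y = T⇒≡true (ℕₚ.<⇒<ᵇ x<y)

  <ᵇ-false : ∀ {x y} → y ≤ x → (x ℕ.<ᵇ y) ≡ false
  <ᵇ-false {x} {y} y≤x with x ℕ.<ᵇ y in eq
  ... | true = ⊥-elim (ℕₚ.<⇒≱ (ℕₚ.<ᵇ⇒< x y (≡true⇒T eq)) y≤x)
  ... | false = refl

  ∨-trueˡ : ∀ {x} y → x ≡ true → x ∨ y ≡ true
  ∨-trueˡ y x≡true = cong (_∨ y) x≡true

  ∨-trueʳ : ∀ x {y} → y ≡ true → x ∨ y ≡ true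
  ∨-trueʳ x y≡true = trans (cong (x ∨_) y≡true) (Boolₚ.∨-zeroʳ x)

  <ᵇ-suc : ∀ {x i} → x ≢ i → (x ℕ.<ᵇ suc i) ≡ (x ℕ.<ᵇ i)
  <ᵇ-suc {zero} {zero} x≢i = ⊥-elim (x≢i refl)
  <ᵇ-suc {zero} {suc i} x≢i = refl
  <ᵇ-suc {suc x} {zero} x≢i = refl
  <ᵇ-suc {suc x} {suc i} x≢i = <ᵇ-suc (λ x≡i → x≢i (cong suc x≡i))

  𝟙 : Bool → ℕ
  𝟙 b = if b then 1 else 0

  𝟙≤1 : ∀ b → 𝟙 b ≤ 1
  𝟙≤1 true = s≤s z≤n
  𝟙≤1 false = z≤n

  countBelow : (ℕ → Bool) → ℕ → ℕ
  countBelow f zero = 0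
  countBelow f (suc n) = countBelow f n + 𝟙 (f n)

  countBelow-≤ : ∀ f n → countBelow f n ≤ n
  countBelow-≤ f zero = z≤n
  countBelow-≤ f (suc n) = ℕₚ.≤-trans (ℕₚ.+-mono-≤ (countBelow-≤ f n) (𝟙≤1 (f n))) (ℕₚ.≤-reflexive (ℕₚ.+-comm n 1))

  countBelow-cong : ∀ f g n → (∀ i → i < n → f i ≡ g i) → countBelow f n ≡ countBelow g n
  countBelow-cong f g zero h = refl
  countBelow-cong f g (suc n) h =
    cong₂ _+_ (countBelow-cong f g n (λ i i<n → h i (ℕₚ.m<n⇒m<1+n i<n))) (cong 𝟙 (h n (ℕₚ.n<1+n n)))

  countBelow-const : ∀ b n → countBelow (λ _ → b) n ≡ 𝟙 b * n
  countBelow-const b zero = sym (ℕₚ.*-zeroʳ (𝟙 b))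
  countBelow-const b (suc n) = trans (cong (_+ 𝟙 b) (countBelow-const b n)) 
    (trans (ℕₚ.+-comm (𝟙 b * n) (𝟙 b)) (sym (ℕₚ.*-suc (𝟙 b) n)))

  countBelow-eventually : ∀ f g N → (∀ i → N ≤ i → f i ≡ g i) → ∀ n → countBelow f n ≤ countBelow g n + N
  countBelow-eventually f g N h zero = z≤n
  countBelow-eventually f g N h (suc n) with N ℕₚ.≤? n
  ... | yes N≤n = begin
    countBelow f n + 𝟙 (f n)       ≡⟨ cong (λ b → countBelow f n + 𝟙 b) (h n N≤n) ⟩
    countBelow f n + 𝟙 (g n)       ≤⟨ ℕₚ.+-monoˡ-≤ (𝟙 (g n)) (countBelow-eventually f g N h n) ⟩
    countBelow g n + N + 𝟙 (g n)   ≡⟨ swap (countBelow g n) N (𝟙 (g n)) ⟩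
    countBelow g n + 𝟙 (g n) + N   ∎
    where
    open ℕₚ.≤-Reasoning
    swap : ∀ a b c → a + b + c ≡ a + c + b
    swap = solve-∀
  ... | no N≰n = ℕₚ.≤-trans (countBelow-≤ f (suc n)) (ℕₚ.≤-trans (ℕₚ.≰⇒> N≰n) (ℕₚ.m≤n+m N _))

  countBelow-+ : ∀ f a b → countBelow f (a + b) ≡ countBelow f b + countBelow (λ i → f (i + b)) a
  countBelow-+ f zero b = sym (ℕₚ.+-identityʳ _)
  countBelow-+ f (suc a) b = trans (cong (_+ 𝟙 (f (a + b))) (countBelow-+ f a b)) (ℕₚ.+-assoc (countBelow f b) _ _)

  countBelow-∨ : ∀ f g n → countBelow (λ x → f x ∨ g x) n ≤ countBelow f n + countBelow g n
  countBelow-∨ f g zero = z≤n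
  countBelow-∨ f g (suc n) = ℕₚ.≤-trans (ℕₚ.+-mono-≤ (countBelow-∨ f g n) (𝟙-∨ (f n) (g n)))
    (ℕₚ.≤-reflexive (interchange (countBelow f n) (countBelow g n) (𝟙 (f n)) (𝟙 (g n))))
    where
    𝟙-∨ : ∀ a b → 𝟙 (a ∨ b) ≤ 𝟙 a + 𝟙 b
    𝟙-∨ true b = s≤s z≤n
    𝟙-∨ false b = ℕₚ.≤-refl
    interchange : ∀ a b c d → (a + b) + (c + d) ≡ (a + c) + (b + d)
    interchange = solve-∀

  countBelow-≡ᵇ0 : ∀ n → countBelow (ℕ._≡ᵇ 0) (suc n) ≡ 1
  countBelow-≡ᵇ0 zero = refl
  countBelow-≡ᵇ0 (suc n) = trans (ℕₚ.+-identityʳ _) (countBelow-≡ᵇ0 n)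

  countBelow-<ᵇ : ∀ s n → countBelow (ℕ._<ᵇ s) n ≤ s
  countBelow-<ᵇ s zero = z≤n
  countBelow-<ᵇ s (suc n) with n ℕₚ.<? s
  ... | yes n<s = ℕₚ.≤-trans (countBelow-≤ (ℕ._<ᵇ s) (suc n)) n<s
  ... | no n≮s = subst (_≤ s) (sym (cong (countBelow (ℕ._<ᵇ s) n +_) (cong 𝟙 (<ᵇ-false (ℕₚ.≮⇒≥ n≮s)))))
                   (ℕₚ.≤-trans (ℕₚ.≤-reflexive (ℕₚ.+-identityʳ _)) (countBelow-<ᵇ s n))

  [i+T*s]%s≡i : ∀ i T s → i < suc s → (i + T * suc s) % suc s ≡ i
  [i+T*s]%s≡i i T s i<s = trans ([m+kn]%n≡m%n i T (suc s)) (m<n⇒m%n≡m i<s)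

  [i+T*s]/s≡T : ∀ i T s → i < suc s → (i + T * suc s) ℕ./ suc s ≡ T
  [i+T*s]/s≡T i T s i<s = trans (+-distrib-/-∣ʳ i (n∣m*n T)) (cong₂ _+_ (m<n⇒m/n≡0 i<s) (m*n/n≡m T (suc s)))

  countBelow-digits : ∀ g h s T →
    countBelow (λ x → g (x % suc s) ∧ h (x ℕ./ suc s)) (T * suc s) ≡ countBelow g (suc s) * countBelow h T
  countBelow-digits g h s zero = sym (ℕₚ.*-zeroʳ (countBelow g (suc s)))
  countBelow-digits g h s (suc T) = begin
    countBelow f (suc s + T * suc s)
      ≡⟨ countBelow-+ f (suc s) (T * suc s) ⟩
    countBelow f (T * suc s) + countBelow (λ i → f (i + T * suc s)) (suc s)
      ≡⟨ cong₂ _+_ (countBelow-digits g h s T) (countBelow-cong _ _ (suc s) (λ i i<s →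
           cong₂ (λ u v → g u ∧ h v) ([i+T*s]%s≡i i T s i<s) ([i+T*s]/s≡T i T s i<s))) ⟩
    cg * countBelow h T + countBelow (λ i → g i ∧ h T) (suc s)
      ≡⟨ cong (cg * countBelow h T +_) (countBelow-∧const g (h T) (suc s)) ⟩
    cg * countBelow h T + cg * 𝟙 (h T)
      ≡⟨ sym (ℕₚ.*-distribˡ-+ cg (countBelow h T) _) ⟩
    cg * countBelow h (suc T) ∎
    where
    open ≡-Reasoning
    f = λ x → g (x % suc s) ∧ h (x ℕ./ suc s)
    cg = countBelow g (suc s)
    countBelow-∧const : ∀ g b t → countBelow (λ i → g i ∧ b) t ≡ countBelow g t * 𝟙 b
    countBelow-∧const g b zero = refl
    countBelow-∧const g b (suc t) = trans (cong₂ _+_ (countBelow-∧const g b t) (𝟙-∧ (g t) b))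
      (sym (ℕₚ.*-distribʳ-+ (𝟙 b) (countBelow g t) (𝟙 (g t))))
      where
      𝟙-∧ : ∀ a b → 𝟙 (a ∧ b) ≡ 𝟙 a * 𝟙 b
      𝟙-∧ true true = refl
      𝟙-∧ true false = refl
      𝟙-∧ false b = refl

  countBelow-evens-odds : ∀ f T → countBelow f (T + T) ≡ countBelow (λ y → f (y * 2)) T + countBelow (λ y → f (suc (y * 2))) T
  countBelow-evens-odds f zero = refl
  countBelow-evens-odds f (suc T) = begin
    countBelow f (suc T + suc T)                   ≡⟨ cong (λ z → countBelow f (suc z)) (ℕₚ.+-suc T T) ⟩
    countBelow f (T + T) + 𝟙 (f (T + T)) + 𝟙 (f (suc (T + T)))
      ≡⟨ cong₂ (λ a b → countBelow f (T + T) + 𝟙 (f a) + 𝟙 (f (suc b))) (double T) (double T) ⟩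
    countBelow f (T + T) + e + o                   ≡⟨ cong (λ z → z + e + o) (countBelow-evens-odds f T) ⟩
    (E + O) + e + o                                ≡⟨ interchange E O e o ⟩
    (E + e) + (O + o)                              ∎
    where
    open ≡-Reasoning
    E = countBelow (λ y → f (y * 2)) T
    O = countBelow (λ y → f (suc (y * 2))) T
    e = 𝟙 (f (T * 2))
    o = 𝟙 (f (suc (T * 2)))
    double : ∀ T → T + T ≡ T * 2
    double = solve-∀
    interchange : ∀ a b c d → (a + b) + c + d ≡ (a + c) + (b + d)
    interchange = solve-∀

  Periodic : ℕ → (ℕ → Bool) → Set
  Periodic N R = ∀ i → R (i + N) ≡ R i

  periodic-* : ∀ {N R} → Periodic N R → ∀ i k → R (i + k * N) ≡ R i
  periodic-* {R = R} p i zero = cong R (ℕₚ.+-identityʳ i)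
  periodic-* {N} {R} p i (suc k) = trans (cong R (shift i N k)) (trans (p (i + k * N)) (periodic-* p i k))
    where
    shift : ∀ i N k → i + suc k * N ≡ (i + k * N) + N
    shift = solve-∀

  periodic-% : ∀ {N R} → Periodic (suc N) R → ∀ n → R (n % suc N) ≡ R n
  periodic-% {N} {R} p n =
    trans (sym (periodic-* p (n % suc N) (n ℕ./ suc N))) (cong R (sym (m≡m%n+[m/n]*n n (suc N))))

  countBelow-periodic : ∀ {N R} → Periodic N R → ∀ k → countBelow R (k * N) ≡ k * countBelow R N
  countBelow-periodic p zero = refl
  countBelow-periodic {N} {R} p (suc k) = trans (countBelow-+ R N (k * N))
    (trans (cong₂ _+_ (countBelow-periodic p k) (countBelow-cong _ _ N (λ i _ → periodic-* p i k)))
      (ℕₚ.+-comm (k * countBelow R N) _))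

  countBelow-periodic-split : ∀ {N R} → Periodic (suc N) R → ∀ n →
    countBelow R n ≡ (n ℕ./ suc N) * countBelow R (suc N) + countBelow R (n % suc N)
  countBelow-periodic-split {N} {R} p n = begin
    countBelow R n                                   ≡⟨ cong (countBelow R) (m≡m%n+[m/n]*n n (suc N)) ⟩
    countBelow R (r + q * suc N)                     ≡⟨ countBelow-+ R r (q * suc N) ⟩
    countBelow R (q * suc N) + countBelow (λ i → R (i + q * suc N)) r
      ≡⟨ cong₂ _+_ (countBelow-periodic p q) (countBelow-cong _ _ r (λ i _ → periodic-* p i q)) ⟩
    q * countBelow R (suc N) + countBelow R r        ∎
    where
    open ≡-Reasoning
    q = n ℕ./ suc N
    r = n % suc N

  periodic-countBelow-lower : ∀ {N R} → Periodic (suc N) R → ∀ n →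
    countBelow R (suc N) * n ≤ suc N * countBelow R n + countBelow R (suc N) * suc N
  periodic-countBelow-lower {N'} {R} p n = begin
    c * n                                 ≡⟨ cong (c *_) (m≡m%n+[m/n]*n n N) ⟩
    c * (r + q * N)                       ≡⟨ expand c r q N ⟩
    N * (q * c) + c * r                   ≤⟨ ℕₚ.+-mono-≤ (ℕₚ.*-monoʳ-≤ N (ℕₚ.m≤m+n (q * c) (countBelow R r)))
                                                          (ℕₚ.*-monoʳ-≤ c (ℕₚ.<⇒≤ (m%n<n n N))) ⟩
    N * (q * c + countBelow R r) + c * N  ≡⟨ cong (λ z → N * z + c * N) (sym (countBelow-periodic-split p n)) ⟩
    N * countBelow R n + c * N            ∎
    where
    open ℕₚ.≤-Reasoning
    N = suc N'
    c = countBelow R N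
    q = n ℕ./ N
    r = n % N
    expand : ∀ c r q N → c * (r + q * N) ≡ N * (q * c) + c * r
    expand = solve-∀

  periodic-countBelow-upper : ∀ {N R} → Periodic (suc N) R → ∀ n →
    suc N * countBelow R n ≤ countBelow R (suc N) * n + suc N * suc N
  periodic-countBelow-upper {N'} {R} p n = begin
    N * countBelow R n                    ≡⟨ cong (N *_) (countBelow-periodic-split p n) ⟩
    N * (q * c + countBelow R r)          ≡⟨ expand N q c (countBelow R r) ⟩
    c * (q * N) + N * countBelow R r      ≤⟨ ℕₚ.+-mono-≤ (ℕₚ.*-monoʳ-≤ c (ℕₚ.m≤n+m (q * N) r))
                                              (ℕₚ.*-monoʳ-≤ N (ℕₚ.≤-trans (countBelow-≤ R r) (ℕₚ.<⇒≤ (m%n<n n N)))) ⟩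
    c * (r + q * N) + N * N               ≡⟨ cong (λ z → c * z + N * N) (sym (m≡m%n+[m/n]*n n N)) ⟩
    c * n + N * N                         ∎
    where
    open ℕₚ.≤-Reasoning
    N = suc N'
    c = countBelow R N
    q = n ℕ./ N
    r = n % N
    expand : ∀ N q c x → N * (q * c + x) ≡ c * (q * N) + N * x
    expand = solve-∀

module Codes where
  open import Data.Nat using (_+_; _*_; _∸_; _≤_; _<_; _%_)
  open import Data.Nat.DivMod using (m≡m%n+[m/n]*n; m%n<n; m%n≤m; [m+kn]%n≡m%n; m<n⇒m%n≡m; m*n%n≡0)
  open import Data.Nat.Divisibility using (_∣_; divides-refl; ∣-trans; m∣m*n; n∣m*n)
  open Counting
  open import Data.Nat.Tactic.RingSolver using (solve-∀)

  inAP-% : ∀ r N n → r < suc N → inAP r (suc N) n ≡ (n % suc N ℕ.≡ᵇ r)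
  inAP-% r N n r<N with r ℕₚ.≤? n
  ... | no r≰n = trans (cong (_∧ ((n ∸ r) % suc N ℕ.≡ᵇ 0)) (≤ᵇ-false r≰n))
                   (sym (≡ᵇ-false (λ n%N≡r → r≰n (subst (_≤ n) n%N≡r (m%n≤m n (suc N))))))
  ... | yes r≤n = trans (cong (_∧ ((n ∸ r) % suc N ℕ.≡ᵇ 0)) (≤ᵇ-true r≤n))
                   (divisible⇔residue (n ∸ r) (ℕₚ.m+[n∸m]≡n r≤n))
    where
    divisible⇔residue : ∀ e → r + e ≡ n → (e % suc N ℕ.≡ᵇ 0) ≡ (n % suc N ℕ.≡ᵇ r)
    divisible⇔residue e refl with e % suc N ℕₚ.≟ 0
    ... | yes e%N≡0 = trans (≡ᵇ-true e%N≡0) (sym (≡ᵇ-true (begin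
      (r + e) % suc N                                    ≡⟨ cong (λ x → (r + x) % suc N) (m≡m%n+[m/n]*n e (suc N)) ⟩
      (r + (e % suc N + e ℕ./ suc N * suc N)) % suc N     ≡⟨ cong (λ x → (r + (x + e ℕ./ suc N * suc N)) % suc N) e%N≡0 ⟩
      (r + e ℕ./ suc N * suc N) % suc N                   ≡⟨ [m+kn]%n≡m%n r (e ℕ./ suc N) (suc N) ⟩
      r % suc N                                           ≡⟨ m<n⇒m%n≡m r<N ⟩
      r                                                   ∎)))
      where open ≡-Reasoning
    ... | no e%N≢0 = trans (≡ᵇ-false e%N≢0) (sym (≡ᵇ-false (λ n%N≡r → e%N≢0 (begin
      e % suc N                                           ≡⟨ cong (_% suc N) (ℕₚ.+-cancelˡ-≡ r e _ (trans
                                                               (m≡m%n+[m/n]*n (r + e) (suc N))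
                                                               (cong (_+ (r + e) ℕ./ suc N * suc N) n%N≡r))) ⟩
      (r + e) ℕ./ suc N * suc N % suc N                    ≡⟨ m*n%n≡0 ((r + e) ℕ./ suc N) (suc N) ⟩
      0                                                   ∎))))
      where open ≡-Reasoning

  residueCode : ℕ → (ℕ → Bool) → ℕ → Code
  residueCode N R zero = []
  residueCode N R (suc i) = if R i then (i , suc N) ∷ residueCode N R i else residueCode N R i

  memb-residueCode : ∀ N R i n → i ≤ suc N → memb (residueCode N R i) n ≡ (R (n % suc N) ∧ (n % suc N ℕ.<ᵇ i))
  memb-residueCode N R zero n _ = sym (Boolₚ.∧-zeroʳ (R (n % suc N)))
  memb-residueCode N R (suc i) n i<N with R i in Ri | n % suc N ℕₚ.≟ i
  ... | true | yes n%N≡i = trans (cong (_∨ memb (residueCode N R i) n) (trans (inAP-% i N n i<N) (≡ᵇ-true n%N≡i)))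
    (sym (subst (λ r → R r ∧ (r ℕ.<ᵇ suc i) ≡ true) (sym n%N≡i) (cong₂ _∧_ Ri (<ᵇ-true (ℕₚ.n<1+n i)))))
  ... | true | no n%N≢i = trans (cong (_∨ memb (residueCode N R i) n) (trans (inAP-% i N n i<N) (≡ᵇ-false n%N≢i)))
    (trans (memb-residueCode N R i n (ℕₚ.<⇒≤ i<N)) (cong (R (n % suc N) ∧_) (sym (<ᵇ-suc n%N≢i))))
  ... | false | yes n%N≡i = trans (memb-residueCode N R i n (ℕₚ.<⇒≤ i<N))
    (trans (cong (_∧ (n % suc N ℕ.<ᵇ i)) R[n%N]) (sym (cong (_∧ (n % suc N ℕ.<ᵇ suc i)) R[n%N])))
    where
    R[n%N] : R (n % suc N) ≡ false
    R[n%N] = trans (cong R n%N≡i) Ri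
  ... | false | no n%N≢i =
    trans (memb-residueCode N R i n (ℕₚ.<⇒≤ i<N)) (cong (R (n % suc N) ∧_) (sym (<ᵇ-suc n%N≢i)))

  periodicCode : ℕ → (ℕ → Bool) → Code
  periodicCode N R = residueCode N R (suc N)

  memb-periodicCode : ∀ {N R} → Periodic (suc N) R → ∀ n → memb (periodicCode N R) n ≡ R n
  memb-periodicCode {N} {R} p n = begin
    memb (periodicCode N R) n                 ≡⟨ memb-residueCode N R (suc N) n ℕₚ.≤-refl ⟩
    R (n % suc N) ∧ (n % suc N ℕ.<ᵇ suc N)     ≡⟨ cong (R (n % suc N) ∧_) (<ᵇ-true (m%n<n n (suc N))) ⟩
    R (n % suc N) ∧ true                       ≡⟨ Boolₚ.∧-identityʳ _ ⟩
    R (n % suc N)                              ≡⟨ periodic-% p n ⟩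
    R n                                        ∎
    where open ≡-Reasoning

  initialSegment : ℕ → Code
  initialSegment zero = []
  initialSegment (suc m) = (m , 0) ∷ initialSegment m

  memb-initialSegment-< : ∀ {m n} → n < m → memb (initialSegment m) n ≡ true
  memb-initialSegment-< {suc m} {n} n<m with n ℕₚ.≟ m
  ... | yes n≡m = ∨-trueˡ (memb (initialSegment m) n) (≡ᵇ-true n≡m)
  ... | no n≢m = ∨-trueʳ (n ℕ.≡ᵇ m) (memb-initialSegment-< (ℕₚ.≤∧≢⇒< (ℕₚ.≤-pred n<m) n≢m))

  memb-initialSegment-≥ : ∀ {m n} → m ≤ n → memb (initialSegment m) n ≡ false
  memb-initialSegment-≥ {zero} m≤n = refl
  memb-initialSegment-≥ {suc m} m≤n =
    cong₂ _∨_ (≡ᵇ-false (λ n≡m → ℕₚ.<-irrefl (sym n≡m) m≤n)) (memb-initialSegment-≥ (ℕₚ.<⇒≤ m≤n))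

  memb-++ : ∀ L L' n → memb (L ++ L') n ≡ (memb L n ∨ memb L' n)
  memb-++ [] L' n = refl
  memb-++ ((a , k) ∷ L) L' n = trans (cong (inAP a k n ∨_) (memb-++ L L' n)) (sym (Boolₚ.∨-assoc (inAP a k n) _ _))

  offsetSum : Code → ℕ
  offsetSum [] = 0
  offsetSum ((a , _) ∷ L) = a + offsetSum L

  period : Code → ℕ
  period [] = 1
  period ((_ , zero) ∷ L) = period L
  period ((_ , suc k) ∷ L) = suc k * period L

  period-suc : ∀ L → ∃[ d ] period L ≡ suc d
  period-suc [] = 0 , refl
  period-suc ((_ , zero) ∷ L) = period-suc L
  period-suc ((_ , suc k) ∷ L) with period-suc L
  ... | d , p≡d = _ , cong (suc k *_) p≡d

  inAP-+period : ∀ a k x m → suc k ∣ m → a ≤ x → inAP a (suc k) (x + m) ≡ inAP a (suc k) x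
  inAP-+period a k x .(q * suc k) (divides-refl q) a≤x = cong₂ _∧_
    (trans (≤ᵇ-true (ℕₚ.≤-trans a≤x (ℕₚ.m≤m+n x (q * suc k)))) (sym (≤ᵇ-true a≤x)))
    (cong (ℕ._≡ᵇ 0) (trans (cong (_% suc k) (ℕₚ.+-∸-comm (q * suc k) a≤x)) ([m+kn]%n≡m%n (x ∸ a) q (suc k))))

  memb-+period : ∀ L {x m} → period L ∣ m → offsetSum L < x → memb L (x + m) ≡ memb L x
  memb-+period [] _ _ = refl
  memb-+period ((a , zero) ∷ L) {x} {m} p∣m o<x = cong₂ _∨_
    (trans (≡ᵇ-false (λ x+m≡a → ℕₚ.<⇒≱ a<x (subst (x ≤_) x+m≡a (ℕₚ.m≤m+n x m)))) (sym (≡ᵇ-false (ℕₚ.>⇒≢ a<x))))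
    (memb-+period L p∣m (ℕₚ.≤-<-trans (ℕₚ.m≤n+m (offsetSum L) a) o<x))
    where
    a<x : a < x
    a<x = ℕₚ.≤-<-trans (ℕₚ.m≤m+n a (offsetSum L)) o<x
  memb-+period ((a , suc k) ∷ L) {x} {m} p∣m o<x = cong₂ _∨_
    (inAP-+period a k x m (∣-trans (m∣m*n (period L)) p∣m) (ℕₚ.<⇒≤ (ℕₚ.≤-<-trans (ℕₚ.m≤m+n a (offsetSum L)) o<x)))
    (memb-+period L (∣-trans (n∣m*n (suc k)) p∣m) (ℕₚ.≤-<-trans (ℕₚ.m≤n+m (offsetSum L) a) o<x))

  count-≤ : ∀ L n → count L n ≤ n
  count-≤ L zero = z≤n
  count-≤ L (suc n) = ℕₚ.+-mono-≤ (𝟙≤1 (memb L (suc n))) (count-≤ L n)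

  count-mono-eventually : ∀ L L' N → (∀ n → N ≤ n → memb L n ≡ true → memb L' n ≡ true) →
    ∀ n → count L n ≤ count L' n + N
  count-mono-eventually L L' N L⊆L' zero = z≤n
  count-mono-eventually L L' N L⊆L' (suc n) with N ℕₚ.≤? suc n
  ... | yes N≤n = ℕₚ.≤-trans (ℕₚ.+-mono-≤ (𝟙-mono (L⊆L' (suc n) N≤n)) (count-mono-eventually L L' N L⊆L' n))
                    (ℕₚ.≤-reflexive (sym (ℕₚ.+-assoc (𝟙 (memb L' (suc n))) _ N)))
    where
    𝟙-mono : ∀ {a b} → (a ≡ true → b ≡ true) → 𝟙 a ≤ 𝟙 b
    𝟙-mono {true} a⇒b rewrite a⇒b refl = ℕₚ.≤-refl
    𝟙-mono {false} a⇒b = z≤n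
  ... | no N≰n = ℕₚ.≤-trans (count-≤ L (suc n)) (ℕₚ.≤-trans (ℕₚ.<⇒≤ (ℕₚ.≰⇒> N≰n)) (ℕₚ.m≤n+m N _))

  count-countBelow : ∀ L n → count L n + 𝟙 (memb L 0) ≡ countBelow (memb L) (suc n)
  count-countBelow L zero = refl
  count-countBelow L (suc n) = trans (rearrange (𝟙 (memb L (suc n))) (𝟙 (memb L 0)) (count L n))
    (cong (_+ 𝟙 (memb L (suc n))) (count-countBelow L n))
    where
    rearrange : ∀ a b c → (a + c) + b ≡ (c + b) + a
    rearrange = solve-∀

  count≤countBelow+1 : ∀ L n → count L n ≤ countBelow (memb L) n + 1
  count≤countBelow+1 L n = ℕₚ.≤-trans (ℕₚ.m≤m+n (count L n) _)
    (ℕₚ.≤-trans (ℕₚ.≤-reflexive (count-countBelow L n)) (ℕₚ.+-monoʳ-≤ _ (𝟙≤1 (memb L n))))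

  countBelow≤count+1 : ∀ L n → countBelow (memb L) n ≤ count L n + 1
  countBelow≤count+1 L n = ℕₚ.≤-trans (ℕₚ.m≤m+n (countBelow (memb L) n) _)
    (ℕₚ.≤-trans (ℕₚ.≤-reflexive (sym (count-countBelow L n))) (ℕₚ.+-monoʳ-≤ _ (𝟙≤1 (memb L 0))))

  eventuallyPeriodic-count : ∀ L N R n₀ → Periodic (suc N) R → (∀ n → n₀ ≤ n → memb L n ≡ R n) →
    ∃[ E ] (∀ n → countBelow R (suc N) * n ≤ suc N * count L n + E)
         × (∀ n → suc N * count L n ≤ countBelow R (suc N) * n + E)
  eventuallyPeriodic-count L N' R n₀ p L≈R = E , lower , upper
    where
    open ℕₚ.≤-Reasoning
    N = suc N'
    c = countBelow R N
    e = n₀ + 1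
    E = N * N + N * e + c * N
    count≤R : ∀ n → count L n ≤ countBelow R n + e
    count≤R n = begin
      count L n                     ≤⟨ count≤countBelow+1 L n ⟩
      countBelow (memb L) n + 1     ≤⟨ ℕₚ.+-monoˡ-≤ 1 (countBelow-eventually (memb L) R n₀ L≈R n) ⟩
      countBelow R n + n₀ + 1       ≡⟨ ℕₚ.+-assoc (countBelow R n) n₀ 1 ⟩
      countBelow R n + e            ∎
    R≤count : ∀ n → countBelow R n ≤ count L n + e
    R≤count n = begin
      countBelow R n                ≤⟨ countBelow-eventually R (memb L) n₀ (λ i n₀≤i → sym (L≈R i n₀≤i)) n ⟩
      countBelow (memb L) n + n₀    ≤⟨ ℕₚ.+-monoˡ-≤ n₀ (countBelow≤count+1 L n) ⟩
      count L n + 1 + n₀            ≡⟨ rearrange (count L n) n₀ ⟩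
      count L n + e                 ∎
      where
      rearrange : ∀ x n₀ → x + 1 + n₀ ≡ x + (n₀ + 1)
      rearrange = solve-∀
    lower : ∀ n → c * n ≤ N * count L n + E
    lower n = begin
      c * n                                    ≤⟨ periodic-countBelow-lower p n ⟩
      N * countBelow R n + c * N               ≤⟨ ℕₚ.+-monoˡ-≤ (c * N) (ℕₚ.*-monoʳ-≤ N (R≤count n)) ⟩
      N * (count L n + e) + c * N              ≡⟨ rearrange N (count L n) e c ⟩
      N * count L n + (N * e + c * N)          ≤⟨ ℕₚ.+-monoʳ-≤ (N * count L n) (ℕₚ.≤-trans (ℕₚ.m≤n+m _ (N * N))
                                                   (ℕₚ.≤-reflexive (sym (ℕₚ.+-assoc (N * N) (N * e) (c * N))))) ⟩
      N * count L n + E                        ∎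
      where
      rearrange : ∀ N x e c → N * (x + e) + c * N ≡ N * x + (N * e + c * N)
      rearrange = solve-∀
    upper : ∀ n → N * count L n ≤ c * n + E
    upper n = begin
      N * count L n                            ≤⟨ ℕₚ.*-monoʳ-≤ N (count≤R n) ⟩
      N * (countBelow R n + e)                 ≡⟨ ℕₚ.*-distribˡ-+ N (countBelow R n) e ⟩
      N * countBelow R n + N * e               ≤⟨ ℕₚ.+-monoˡ-≤ (N * e) (periodic-countBelow-upper p n) ⟩
      c * n + N * N + N * e                    ≤⟨ ℕₚ.m≤m+n _ (c * N) ⟩
      c * n + N * N + N * e + c * N            ≡⟨ rearrange (c * n) (N * N) (N * e) (c * N) ⟩
      c * n + E                                ∎
      where
      rearrange : ∀ a b c d → a + b + c + d ≡ a + (b + c + d)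
      rearrange = solve-∀

module Densities where
  open ℚ using (_+_; _≤_)
  open import Data.Integer using (+_)
  open import Data.Rational.Solver using (module +-*-Solver)
  open +-*-Solver using (solve; _:+_; _:=_)
  open import Data.Nat.Tactic.RingSolver using (solve-∀)
  open Fractions
  open Counting
  open Codes

  density-mono-count : ∀ L L' {q q'} c → (∀ n → count L n ℕ.≤ count L' n ℕ.+ c) →
    HasDensity L q → HasDensity L' q' → q ≤ q'
  density-mono-count L L' {q} {q'} c L≤L' dL dL' = ≤-by-inv q q' q≤q'+inv
    where
    q≤q'+inv : ∀ j → q ≤ q' + inv j
    q≤q'+inv j = begin
      q                     ≤⟨ ∣p-q∣≤r⇒q≤p+r x q i (proj₂ (dL k) m N₁≤m) ⟩
      x + i                 ≤⟨ ℚₚ.+-monoˡ-≤ i x≤x'+i ⟩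
      (x' + i) + i          ≤⟨ ℚₚ.+-monoˡ-≤ i (ℚₚ.+-monoˡ-≤ i (∣p-q∣≤r⇒p≤q+r x' q' i (proj₂ (dL' k) m N₂≤m))) ⟩
      ((q' + i) + i) + i    ≡⟨ solve 2 (λ q' i → ((q' :+ i) :+ i) :+ i := q' :+ ((i :+ i) :+ i)) refl q' i ⟩
      q' + ((i + i) + i)    ≤⟨ ℚₚ.+-monoʳ-≤ q' (inv-third j) ⟩
      q' + inv j            ∎
      where
      open ℚₚ.≤-Reasoning
      k = third j
      i = inv k
      N₁ = proj₁ (dL k)
      N₂ = proj₁ (dL' k)
      m = N₁ ℕ.+ N₂ ℕ.+ c ℕ.* suc k
      N₁≤m : N₁ ℕ.≤ m
      N₁≤m = ℕₚ.≤-trans (ℕₚ.m≤m+n N₁ N₂) (ℕₚ.m≤m+n (N₁ ℕ.+ N₂) _)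
      N₂≤m : N₂ ℕ.≤ m
      N₂≤m = ℕₚ.≤-trans (ℕₚ.m≤n+m N₂ N₁) (ℕₚ.m≤m+n (N₁ ℕ.+ N₂) _)
      a = count L (suc m)
      b = count L' (suc m)
      x = + a / suc m
      x' = + b / suc m
      ck≤m : c ℕ.* suc k ℕ.≤ suc m
      ck≤m = ℕₚ.m≤n⇒m≤1+n (ℕₚ.m≤n+m (c ℕ.* suc k) (N₁ ℕ.+ N₂))
      x≤x'+i : x ≤ x' + i
      x≤x'+i = frac-≤-+inv a b m m (c ℕ.* suc m) k
        (ℕₚ.≤-trans (ℕₚ.*-monoˡ-≤ (suc m) (L≤L' (suc m))) (ℕₚ.≤-reflexive (ℕₚ.*-distribʳ-+ (suc m) b c)))
        (ℕₚ.≤-trans (ℕₚ.≤-reflexive (swap c m k)) (ℕₚ.*-monoˡ-≤ (suc m) ck≤m))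
        where
        swap : ∀ c m k → c ℕ.* suc m ℕ.* suc k ≡ c ℕ.* suc k ℕ.* suc m
        swap = solve-∀

  density-mono : ∀ L L' {q q'} N → (∀ n → N ℕ.≤ n → memb L n ≡ true → memb L' n ≡ true) →
    HasDensity L q → HasDensity L' q' → q ≤ q'
  density-mono L L' N L⊆L' = density-mono-count L L' N (count-mono-eventually L L' N L⊆L')

  hasDensity-intro : ∀ L c N E → (∀ n → c ℕ.* n ℕ.≤ suc N ℕ.* count L n ℕ.+ E) →
    (∀ n → suc N ℕ.* count L n ℕ.≤ c ℕ.* n ℕ.+ E) → HasDensity L (+ c / suc N)
  hasDensity-intro L c N E lower upper j = E ℕ.* suc j , λ m Ej≤m →
    p≤q+r∧q≤p+r⇒∣p-q∣≤r (+ count L (suc m) / suc m) (+ c / suc N) (inv j)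
      (frac-≤-+inv (count L (suc m)) c m N E j
        (subst (ℕ._≤ c ℕ.* suc m ℕ.+ E) (ℕₚ.*-comm (suc N) _) (upper (suc m)))
        (ℕₚ.≤-trans (ℕₚ.m≤n⇒m≤1+n Ej≤m) (ℕₚ.m≤m*n (suc m) (suc N))))
      (frac-≤-+inv c (count L (suc m)) N m E j
        (subst (c ℕ.* suc m ℕ.≤_) (cong (ℕ._+ E) (ℕₚ.*-comm (suc N) _)) (lower (suc m)))
        (ℕₚ.≤-trans (ℕₚ.m≤n⇒m≤1+n Ej≤m) (ℕₚ.m≤n*m (suc m) (suc N))))

  eventuallyPeriodic-density : ∀ L N R n₀ → Periodic (suc N) R → (∀ n → n₀ ℕ.≤ n → memb L n ≡ R n) →
    HasDensity L (+ countBelow R (suc N) / suc N)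
  eventuallyPeriodic-density L N R n₀ p L≈R with eventuallyPeriodic-count L N R n₀ p L≈R
  ... | E , lower , upper = hasDensity-intro L (countBelow R (suc N)) N E lower upper

  periodicCode-density : ∀ {N R} → Periodic (suc N) R → HasDensity (periodicCode N R) (+ countBelow R (suc N) / suc N)
  periodicCode-density {N} {R} p = eventuallyPeriodic-density (periodicCode N R) N R 0 p (λ n _ → memb-periodicCode p n)

  sandwich-density : ∀ {X} L L' {q q'} → ⟦ L ⟧ ⊆ X → X ⊆ ⟦ L' ⟧ → HasDensity L q → HasDensity L' q' → q ≤ q'
  sandwich-density L L' L⊆X X⊆L' = density-mono L L' 0 (λ n _ n∈L → X⊆L' n (L⊆X n n∈L))

module BuckDensities where
  open ℚ using (_+_; _-_; -_; _<_)
  open import Data.Rational.Solver using (module +-*-Solver)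
  open +-*-Solver using (solve; _:+_; _:-_; _:=_)
  open Densities

  buckDensity-intro : ∀ X α →
    (∀ q → q q<ʳ α → ∃[ L ] ∃[ q' ] (⟦ L ⟧ ⊆ X × HasDensity L q' × q < q')) →
    (∀ q → α <ʳq q → ∃[ L ] ∃[ q' ] (X ⊆ ⟦ L ⟧ × HasDensity L q' × q' < q)) →
    BuckDensity= X α
  buckDensity-intro X α inner outer = (below-outer , outer) , (above-inner , inner)
    where
    below-outer : ∀ L q → X ⊆ ⟦ L ⟧ → HasDensity L q → α ≤ʳq q
    below-outer L q X⊆L dL n with seq α n ℚₚ.≤? q + inv n
    ... | yes αₙ≤q+i = αₙ≤q+i
    ... | no αₙ≰q+i = ⊥-elim (no-inner (inner q (n , q<αₙ-i)))
      where
      q<αₙ-i : q < seq α n - inv n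
      q<αₙ-i = subst (_< seq α n - inv n) (solve 2 (λ q i → (q :+ i) :- i := q) refl q (inv n))
        (ℚₚ.+-monoˡ-< (- inv n) (ℚₚ.≰⇒> αₙ≰q+i))
      no-inner : ¬ (∃[ L' ] ∃[ q' ] (⟦ L' ⟧ ⊆ X × HasDensity L' q' × q < q'))
      no-inner (L' , q' , L'⊆X , dL' , q<q') = ℚₚ.<-irrefl refl (ℚₚ.<-≤-trans q<q' (sandwich-density L' L L'⊆X X⊆L dL' dL))
    above-inner : ∀ L q → ⟦ L ⟧ ⊆ X → HasDensity L q → q q≤ʳ α
    above-inner L q L⊆X dL n with q ℚₚ.≤? seq α n + inv n
    ... | yes q≤αₙ+i = q≤αₙ+i
    ... | no q≰αₙ+i = ⊥-elim (no-outer (outer q (n , ℚₚ.≰⇒> q≰αₙ+i)))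
      where
      no-outer : ¬ (∃[ L' ] ∃[ q' ] (X ⊆ ⟦ L' ⟧ × HasDensity L' q' × q' < q))
      no-outer (L' , q' , X⊆L' , dL' , q'<q) = ℚₚ.<-irrefl refl (ℚₚ.<-≤-trans q'<q (sandwich-density L L' L⊆X X⊆L' dL dL'))

module BitReversal where
  open import Data.Nat using (_+_; _*_; _∸_; _≤_; _<_; _%_)
  open import Data.Nat.DivMod using (m%n<n; [m+kn]%n≡m%n; m*n%n≡0; m*n/n≡m; +-distrib-/-∣ʳ)
  open import Data.Nat.Divisibility using (n∣m*n)
  open import Data.Nat.Tactic.RingSolver using (solve-∀)
  open Counting

  2^∸1 : ℕ → ℕ
  2^∸1 zero = 0
  2^∸1 (suc K) = 2^∸1 K + suc (2^∸1 K)

  -- Written as a successor, so that 2^ K * d is a denominator that is nonzero by computation.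
  2^ : ℕ → ℕ
  2^ K = suc (2^∸1 K)

  2^-+ : ∀ j k → 2^ (j + k) ≡ 2^ j * 2^ k
  2^-+ zero k = sym (ℕₚ.+-identityʳ (2^ k))
  2^-+ (suc j) k = trans (cong₂ _+_ (2^-+ j k) (2^-+ j k)) (sym (ℕₚ.*-distribʳ-+ (2^ k) (2^ j) (2^ j)))

  n<2^n : ∀ n → n < 2^ n
  n<2^n zero = ℕₚ.≤-refl
  n<2^n (suc n) = ℕₚ.≤-trans (ℕₚ.≤-reflexive (ℕₚ.+-comm 1 (suc n))) (ℕₚ.+-mono-≤ (n<2^n n) (ℕₚ.≤-trans (s≤s z≤n) (n<2^n n)))

  bitReverse : ℕ → ℕ → ℕ
  bitReverse zero x = 0
  bitReverse (suc k) x = (x % 2) * 2^ k + bitReverse k (x ℕ./ 2)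

  private
    x%2≤1 : ∀ x → x % 2 ≤ 1
    x%2≤1 x = ℕₚ.≤-pred (m%n<n x 2)

  bitReverse<2^ : ∀ k x → bitReverse k x < 2^ k
  bitReverse<2^ zero x = s≤s z≤n
  bitReverse<2^ (suc k) x = begin
    suc ((x % 2) * 2^ k + bitReverse k (x ℕ./ 2))   ≡⟨ sym (ℕₚ.+-suc _ _) ⟩
    (x % 2) * 2^ k + suc (bitReverse k (x ℕ./ 2))   ≤⟨ ℕₚ.+-mono-≤ (ℕₚ.≤-trans (ℕₚ.*-monoˡ-≤ (2^ k) (x%2≤1 x))
                                                        (ℕₚ.≤-reflexive (ℕₚ.+-identityʳ (2^ k)))) (bitReverse<2^ k (x ℕ./ 2)) ⟩
    2^ k + 2^ k                                      ∎
    where open ℕₚ.≤-Reasoning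

  bitReverse-+2^ : ∀ k x → bitReverse k (x + 2^ k) ≡ bitReverse k x
  bitReverse-+2^ zero x = refl
  bitReverse-+2^ (suc k) x = cong₂ (λ b r → b * 2^ k + r) x+2^k%2 (trans (cong (bitReverse k) x+2^k/2) (bitReverse-+2^ k (x ℕ./ 2)))
    where
    double : x + (2^ k + 2^ k) ≡ x + 2^ k * 2
    double = cong (x +_) (p+p≡p*2 (2^ k))
      where
      p+p≡p*2 : ∀ p → p + p ≡ p * 2
      p+p≡p*2 = solve-∀
    x+2^k%2 : (x + (2^ k + 2^ k)) % 2 ≡ x % 2
    x+2^k%2 = trans (cong (_% 2) double) ([m+kn]%n≡m%n x (2^ k) 2)
    x+2^k/2 : (x + (2^ k + 2^ k)) ℕ./ 2 ≡ x ℕ./ 2 + 2^ k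
    x+2^k/2 = trans (cong (ℕ._/ 2) double) (trans (+-distrib-/-∣ʳ x (n∣m*n (2^ k))) (cong (x ℕ./ 2 +_) (m*n/n≡m (2^ k) 2)))

  bitReverse-suc : ∀ k x → 2 * bitReverse k x ≤ bitReverse (suc k) x × bitReverse (suc k) x ≤ 2 * bitReverse k x + 1
  bitReverse-suc zero x = z≤n , ℕₚ.≤-trans (ℕₚ.≤-reflexive (trans (ℕₚ.+-identityʳ _) (ℕₚ.*-identityʳ (x % 2)))) (x%2≤1 x)
  bitReverse-suc (suc k) x =
    ℕₚ.≤-trans (ℕₚ.≤-reflexive (lower-eq (x % 2) (2^ k) r)) (ℕₚ.+-monoʳ-≤ high (proj₁ (bitReverse-suc k (x ℕ./ 2)))) ,
    ℕₚ.≤-trans (ℕₚ.+-monoʳ-≤ high (proj₂ (bitReverse-suc k (x ℕ./ 2)))) (ℕₚ.≤-reflexive (upper-eq (x % 2) (2^ k) r))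
    where
    r = bitReverse k (x ℕ./ 2)
    high = (x % 2) * (2^ k + 2^ k)
    lower-eq : ∀ b p r → 2 * (b * p + r) ≡ b * (p + p) + 2 * r
    lower-eq = solve-∀
    upper-eq : ∀ b p r → b * (p + p) + (2 * r + 1) ≡ 2 * (b * p + r) + 1
    upper-eq = solve-∀

  bitReverse-lower : ∀ k j x → bitReverse k x * 2^ j ≤ bitReverse (j + k) x
  bitReverse-lower k zero x = ℕₚ.≤-reflexive (ℕₚ.*-identityʳ (bitReverse k x))
  bitReverse-lower k (suc j) x = ℕₚ.≤-trans (ℕₚ.≤-reflexive (double (bitReverse k x) (2^ j)))
    (ℕₚ.≤-trans (ℕₚ.*-monoʳ-≤ 2 (bitReverse-lower k j x)) (proj₁ (bitReverse-suc (j + k) x)))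
    where
    double : ∀ r p → r * (p + p) ≡ 2 * (r * p)
    double = solve-∀

  bitReverse-upper : ∀ k j x → suc (bitReverse (j + k) x) ≤ suc (bitReverse k x) * 2^ j
  bitReverse-upper k zero x = ℕₚ.≤-reflexive (sym (ℕₚ.*-identityʳ _))
  bitReverse-upper k (suc j) x = ℕₚ.≤-trans (s≤s (proj₂ (bitReverse-suc (j + k) x)))
    (ℕₚ.≤-trans (ℕₚ.≤-reflexive (suc-double (bitReverse (j + k) x)))
      (ℕₚ.≤-trans (ℕₚ.*-monoʳ-≤ 2 (bitReverse-upper k j x)) (ℕₚ.≤-reflexive (double (suc (bitReverse k x)) (2^ j)))))
    where
    suc-double : ∀ r → suc (2 * r + 1) ≡ 2 * suc r
    suc-double = solve-∀
    double : ∀ r p → 2 * (r * p) ≡ r * (p + p)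
    double = solve-∀

  -- In dyadic terms: bitReverse K x / 2^ K < (bitReverse k x + 1) / 2^ k, whichever of k, K is larger.
  bitReverse-dyadic : ∀ k K x → bitReverse K x * 2^ k < suc (bitReverse k x) * 2^ K
  bitReverse-dyadic k K x with ℕₚ.≤-total k K
  ... | inj₁ k≤K = subst (λ K → bitReverse K x * 2^ k < suc (bitReverse k x) * 2^ K) (ℕₚ.m∸n+n≡m k≤K) (coarser (K ∸ k))
    where
    coarser : ∀ j → bitReverse (j + k) x * 2^ k < suc (bitReverse k x) * 2^ (j + k)
    coarser j = begin-strict
      bitReverse (j + k) x * 2^ k            <⟨ ℕₚ.*-monoˡ-< (2^ k) (ℕₚ.n<1+n (bitReverse (j + k) x)) ⟩
      suc (bitReverse (j + k) x) * 2^ k      ≤⟨ ℕₚ.*-monoˡ-≤ (2^ k) (bitReverse-upper k j x) ⟩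
      suc (bitReverse k x) * 2^ j * 2^ k     ≡⟨ ℕₚ.*-assoc (suc (bitReverse k x)) (2^ j) (2^ k) ⟩
      suc (bitReverse k x) * (2^ j * 2^ k)   ≡⟨ cong (suc (bitReverse k x) *_) (sym (2^-+ j k)) ⟩
      suc (bitReverse k x) * 2^ (j + k)      ∎
      where open ℕₚ.≤-Reasoning
  ... | inj₂ K≤k = subst (λ k → bitReverse K x * 2^ k < suc (bitReverse k x) * 2^ K) (ℕₚ.m∸n+n≡m K≤k) (finer (k ∸ K))
    where
    finer : ∀ j → bitReverse K x * 2^ (j + K) < suc (bitReverse (j + K) x) * 2^ K
    finer j = begin-strict
      bitReverse K x * 2^ (j + K)            ≡⟨ cong (bitReverse K x *_) (2^-+ j K) ⟩
      bitReverse K x * (2^ j * 2^ K)         ≡⟨ sym (ℕₚ.*-assoc (bitReverse K x) (2^ j) (2^ K)) ⟩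
      bitReverse K x * 2^ j * 2^ K           ≤⟨ ℕₚ.*-monoˡ-≤ (2^ K) (bitReverse-lower K j x) ⟩
      bitReverse (j + K) x * 2^ K            <⟨ ℕₚ.*-monoˡ-< (2^ K) (ℕₚ.n<1+n (bitReverse (j + K) x)) ⟩
      suc (bitReverse (j + K) x) * 2^ K      ∎
      where open ℕₚ.≤-Reasoning

  countBelow-bitReverse< : ∀ K a → a ≤ 2^ K → countBelow (λ x → bitReverse K x ℕ.<ᵇ a) (2^ K) ≡ a
  countBelow-bitReverse< zero zero _ = refl
  countBelow-bitReverse< zero (suc zero) _ = refl
  countBelow-bitReverse< zero (suc (suc a)) (s≤s ())
  countBelow-bitReverse< (suc K) a a≤2^K+2^K = begin
    countBelow f (2^ K + 2^ K)
      ≡⟨ countBelow-evens-odds f (2^ K) ⟩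
    countBelow (λ y → f (y * 2)) (2^ K) + countBelow (λ y → f (suc (y * 2))) (2^ K)
      ≡⟨ cong₂ _+_ (countBelow-cong _ _ (2^ K) (λ y _ → evens y)) (countBelow-cong _ _ (2^ K) (λ y _ → odds y)) ⟩
    countBelow low (2^ K) + countBelow high (2^ K)
      ≡⟨ halves (a ℕₚ.≤? 2^ K) ⟩
    a ∎
    where
    open ≡-Reasoning
    f = λ x → bitReverse (suc K) x ℕ.<ᵇ a
    low = λ y → bitReverse K y ℕ.<ᵇ a
    high = λ y → 2^ K + bitReverse K y ℕ.<ᵇ a
    evens : ∀ y → f (y * 2) ≡ low y
    evens y = cong₂ (λ b r → b * 2^ K + bitReverse K r ℕ.<ᵇ a) (m*n%n≡0 y 2) (m*n/n≡m y 2)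
    odds : ∀ y → f (suc (y * 2)) ≡ high y
    odds y = trans
      (cong₂ (λ b r → b * 2^ K + bitReverse K r ℕ.<ᵇ a) ([i+T*s]%s≡i 1 y 1 ℕₚ.≤-refl) ([i+T*s]/s≡T 1 y 1 ℕₚ.≤-refl))
      (cong (λ p → p + bitReverse K y ℕ.<ᵇ a) (ℕₚ.+-identityʳ (2^ K)))
    +-<ᵇ-+ : ∀ c x y → (c + x ℕ.<ᵇ c + y) ≡ (x ℕ.<ᵇ y)
    +-<ᵇ-+ zero x y = refl
    +-<ᵇ-+ (suc c) x y = +-<ᵇ-+ c x y
    halves : Dec (a ≤ 2^ K) → countBelow low (2^ K) + countBelow high (2^ K) ≡ a
    halves (yes a≤2^K) = trans (cong₂ _+_ (countBelow-bitReverse< K a a≤2^K)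
      (trans (countBelow-cong _ _ (2^ K) (λ y _ → <ᵇ-false (ℕₚ.≤-trans a≤2^K (ℕₚ.m≤m+n (2^ K) _))))
        (countBelow-const false (2^ K))))
      (ℕₚ.+-identityʳ a)
    halves (no a≰2^K) = begin
      countBelow low (2^ K) + countBelow high (2^ K)
        ≡⟨ cong₂ _+_ (countBelow-cong _ _ (2^ K) (λ y _ → <ᵇ-true (ℕₚ.<-trans (bitReverse<2^ K y) (ℕₚ.≰⇒> a≰2^K))))
                     (countBelow-cong _ _ (2^ K) (λ y _ → trans (cong (λ a → 2^ K + bitReverse K y ℕ.<ᵇ a) a≡2^K+a')
                                                                   (+-<ᵇ-+ (2^ K) (bitReverse K y) a'))) ⟩
      countBelow (λ _ → true) (2^ K) + countBelow (λ y → bitReverse K y ℕ.<ᵇ a') (2^ K)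
        ≡⟨ cong₂ _+_ (trans (countBelow-const true (2^ K)) (ℕₚ.*-identityˡ (2^ K))) (countBelow-bitReverse< K a' a'≤2^K) ⟩
      2^ K + a'
        ≡⟨ sym a≡2^K+a' ⟩
      a ∎
      where
      a' = a ∸ 2^ K
      a≡2^K+a' : a ≡ 2^ K + a'
      a≡2^K+a' = sym (ℕₚ.m+[n∸m]≡n (ℕₚ.<⇒≤ (ℕₚ.≰⇒> a≰2^K)))
      a'≤2^K : a' ≤ 2^ K
      a'≤2^K = ℕₚ.+-cancelˡ-≤ (2^ K) a' (2^ K) (subst (_≤ 2^ K + 2^ K) a≡2^K+a' a≤2^K+2^K)

  innerPattern : ℕ → ℕ → ℕ → Bool
  innerPattern K a n = (n % 4 ℕ.≡ᵇ 0) ∧ (bitReverse K (n ℕ./ 4) ℕ.<ᵇ a)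

  countBelow-innerPattern : ∀ K a → a ≤ 2^ K → countBelow (innerPattern K a) (2^ K * 4) ≡ a
  countBelow-innerPattern K a a≤2^K = trans (countBelow-digits (ℕ._≡ᵇ 0) (λ y → bitReverse K y ℕ.<ᵇ a) 3 (2^ K))
    (trans (ℕₚ.*-identityˡ _) (countBelow-bitReverse< K a a≤2^K))

  innerPattern-periodic : ∀ K a → Periodic (2^ K * 4) (innerPattern K a)
  innerPattern-periodic K a n = cong₂ (λ r ρ → (r ℕ.≡ᵇ 0) ∧ (ρ ℕ.<ᵇ a)) ([m+kn]%n≡m%n n (2^ K) 4)
    (trans (cong (bitReverse K) (trans (+-distrib-/-∣ʳ n (n∣m*n (2^ K))) (cong (n ℕ./ 4 +_) (m*n/n≡m (2^ K) 4))))
      (bitReverse-+2^ K (n ℕ./ 4)))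

  innerPattern-true : ∀ K a n → innerPattern K a n ≡ true → n % 4 ≡ 0 × bitReverse K (n ℕ./ 4) < a
  innerPattern-true K a n h with Equivalence.to Boolₚ.T-∧ (≡true⇒T h)
  ... | n%4≡0 , ρ<a = ℕₚ.≡ᵇ⇒≡ (n % 4) 0 n%4≡0 , ℕₚ.<ᵇ⇒< _ a ρ<a

module MixedRadix where
  open import Data.Nat using (_+_; _*_; _∸_; _≤_; _<_; _%_)
  open import Data.Nat.DivMod using (m≡m%n+[m/n]*n; m%n<n; m%n%n≡m%n; [m+kn]%n≡m%n; m*n%n≡0; m*n/n≡m;
    +-distrib-/-∣ʳ; m<n*o⇒m/o<n)
  open import Data.Nat.Divisibility using (_∣_; n∣m*n; m∣m*n; ∣-trans; ∣n⇒∣m*n; *-monoʳ-∣; 1∣_)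
  open import Data.Nat.Tactic.RingSolver using (solve-∀)
  open import Data.Unit using (⊤)
  open Counting
  open BitReversal using (2^)

  -- Mixed radix with bases 4, 4², 8², 12², …; radix i k = base i ⋯ base (i + k - 1).
  base∸1 : ℕ → ℕ
  base∸1 zero = 3
  base∸1 (suc i) = ℕ.pred ((4 * suc i) * (4 * suc i))

  base : ℕ → ℕ
  base i = suc (base∸1 i)

  digitSet : ℕ → ℕ → Bool
  digitSet zero d = d ℕ.≤ᵇ 1
  digitSet (suc i) d = (d ℕ.<ᵇ 4 * suc i) ∨ (d % (4 * suc i) ℕ.≡ᵇ 0)

  radix∸1 : ℕ → ℕ → ℕ
  radix∸1 i zero = 0
  radix∸1 i (suc k) = radix∸1 (suc i) k + base∸1 i * suc (radix∸1 (suc i) k)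

  radix : ℕ → ℕ → ℕ
  radix i k = suc (radix∸1 i k)

  goodDigits : ℕ → ℕ → ℕ → Bool
  goodDigits i zero n = true
  goodDigits i (suc k) n = digitSet i (n % base i) ∧ goodDigits (suc i) k (n ℕ./ base i)

  goodDigits-digit : ∀ i k u r → u < base i → goodDigits i (suc k) (u + r * base i) ≡ digitSet i u ∧ goodDigits (suc i) k r
  goodDigits-digit i k u r u<b =
    cong₂ (λ d q → digitSet i d ∧ goodDigits (suc i) k q) ([i+T*s]%s≡i u r (base∸1 i) u<b) ([i+T*s]/s≡T u r (base∸1 i) u<b)

  goodDigits-periodic : ∀ k i → Periodic (radix i k) (goodDigits i k)
  goodDigits-periodic zero i n = refl
  goodDigits-periodic (suc k) i n =
    cong₂ (λ d q → digitSet i d ∧ q) n+R%b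
      (trans (cong (goodDigits (suc i) k) n+R/b) (goodDigits-periodic k (suc i) (n ℕ./ base i)))
    where
    R = radix (suc i) k
    n+R≡ : n + radix i (suc k) ≡ n + R * base i
    n+R≡ = cong (n +_) (ℕₚ.*-comm (base i) R)
    n+R%b : (n + radix i (suc k)) % base i ≡ n % base i
    n+R%b = trans (cong (_% base i) n+R≡) ([m+kn]%n≡m%n n R (base i))
    n+R/b : (n + radix i (suc k)) ℕ./ base i ≡ n ℕ./ base i + R
    n+R/b = trans (cong (ℕ._/ base i) n+R≡)
      (trans (+-distrib-/-∣ʳ n (n∣m*n R)) (cong (n ℕ./ base i +_) (m*n/n≡m R (base i))))

  goodDigits-prefix : ∀ k m i n → goodDigits i (k + m) n ≡ true → goodDigits i k n ≡ true
  goodDigits-prefix zero m i n _ = refl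
  goodDigits-prefix (suc k) m i n h with digitSet i (n % base i)
  ... | true = goodDigits-prefix k m (suc i) (n ℕ./ base i) h

  -- Digit sets at positions > 0 are additive bases of [0, base i); at position 0 only {0,1,2} = {0,1} + {0,1}.
  Representable : ℕ → ℕ → Set
  Representable zero z = z % 4 ≤ 2
  Representable (suc i) z = ⊤

  Representable-% : ∀ i z → Representable i z → Representable i (z % base i)
  Representable-% zero z z%4≤2 = subst (_≤ 2) (sym (m%n%n≡m%n z 4)) z%4≤2
  Representable-% (suc i) z _ = _

  digitSet-sum : ∀ i d → d < base i → Representable i d →
    ∃[ u ] ∃[ v ] digitSet i u ≡ true × digitSet i v ≡ true × u + v ≡ d
  digitSet-sum zero 0 _ _ = 0 , 0 , refl , refl , refl
  digitSet-sum zero 1 _ _ = 1 , 0 , refl , refl , refl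
  digitSet-sum zero 2 _ _ = 1 , 1 , refl , refl , refl
  digitSet-sum zero 3 _ (s≤s (s≤s ()))
  digitSet-sum zero (suc (suc (suc (suc d)))) (s≤s (s≤s (s≤s (s≤s ())))) _
  digitSet-sum (suc i) d _ _ = d % s , (d ℕ./ s) * s ,
    ∨-trueˡ ((d % s) % s ℕ.≡ᵇ 0) (<ᵇ-true (m%n<n d s)) ,
    ∨-trueʳ ((d ℕ./ s) * s ℕ.<ᵇ s) (≡ᵇ-true (m*n%n≡0 (d ℕ./ s) s)) ,
    sym (m≡m%n+[m/n]*n d s)
    where s = 4 * suc i

  goodDigits-sum : ∀ k i z → z < radix i k → Representable i z →
    ∃[ r ] ∃[ r' ] goodDigits i k r ≡ true × goodDigits i k r' ≡ true × r + r' ≡ z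
  goodDigits-sum zero i zero _ _ = 0 , 0 , refl , refl , refl
  goodDigits-sum zero i (suc z) (s≤s ()) _
  goodDigits-sum (suc k) i z z<R rep
    with digitSet-sum i (z % base i) (m%n<n z (base i)) (Representable-% i z rep)
       | goodDigits-sum k (suc i) (z ℕ./ base i) (m<n*o⇒m/o<n (subst (z <_) (ℕₚ.*-comm (base i) _) z<R)) _
  ... | u , v , u∈S , v∈S , u+v≡d | r , r' , r∈G , r'∈G , r+r'≡q =
    u + r * base i , v + r' * base i ,
    trans (goodDigits-digit i k u r u<b) (cong₂ _∧_ u∈S r∈G) ,
    trans (goodDigits-digit i k v r' v<b) (cong₂ _∧_ v∈S r'∈G) ,
    trans (interchange u v r r' (base i))
      (trans (cong₂ (λ d q → d + q * base i) u+v≡d r+r'≡q) (sym (m≡m%n+[m/n]*n z (base i))))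
    where
    u<b : u < base i
    u<b = ℕₚ.≤-<-trans (subst (u ≤_) u+v≡d (ℕₚ.m≤m+n u v)) (m%n<n z (base i))
    v<b : v < base i
    v<b = ℕₚ.≤-<-trans (subst (v ≤_) u+v≡d (ℕₚ.m≤n+m v u)) (m%n<n z (base i))
    interchange : ∀ u v a b t → (u + a * t) + (v + b * t) ≡ (u + v) + (a + b) * t
    interchange = solve-∀

  digitSet-half : ∀ i → 2 * countBelow (digitSet i) (base i) ≤ base i
  digitSet-half zero = ℕₚ.≤-refl
  digitSet-half (suc i) = begin
    2 * countBelow (digitSet (suc i)) (s * s)
      ≤⟨ ℕₚ.*-monoʳ-≤ 2 (countBelow-∨ _ _ (s * s)) ⟩
    2 * (countBelow (ℕ._<ᵇ s) (s * s) + countBelow (λ d → d % s ℕ.≡ᵇ 0) (s * s))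
      ≤⟨ ℕₚ.*-monoʳ-≤ 2 (ℕₚ.+-mono-≤ (countBelow-<ᵇ s (s * s)) (ℕₚ.≤-reflexive multiples)) ⟩
    2 * (s + s)
      ≡⟨ double s ⟩
    4 * s
      ≤⟨ ℕₚ.*-monoˡ-≤ s (ℕₚ.*-monoʳ-≤ 4 {1} {suc i} (s≤s z≤n)) ⟩
    s * s ∎
    where
    open ℕₚ.≤-Reasoning
    s = 4 * suc i
    double : ∀ s → 2 * (s + s) ≡ 4 * s
    double = solve-∀
    multiples : countBelow (λ d → d % s ℕ.≡ᵇ 0) (s * s) ≡ s
    multiples = trans (countBelow-cong _ _ (s * s) (λ d _ → sym (Boolₚ.∧-identityʳ _)))
      (trans (countBelow-digits (ℕ._≡ᵇ 0) (λ _ → true) (ℕ.pred s) s)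
        (trans (cong₂ _*_ (countBelow-≡ᵇ0 (ℕ.pred s)) (countBelow-const true s))
          (trans (ℕₚ.*-identityˡ _) (ℕₚ.*-identityˡ s))))

  countBelow-goodDigits : ∀ k i → countBelow (goodDigits i k) (radix i k) * 2^ k ≤ radix i k
  countBelow-goodDigits zero i = ℕₚ.≤-refl
  countBelow-goodDigits (suc k) i = begin
    countBelow (goodDigits i (suc k)) (base i * R) * (2^ k + 2^ k)
      ≡⟨ cong (λ n → countBelow (goodDigits i (suc k)) n * (2^ k + 2^ k)) (ℕₚ.*-comm (base i) R) ⟩
    countBelow (goodDigits i (suc k)) (R * base i) * (2^ k + 2^ k)
      ≡⟨ cong (_* (2^ k + 2^ k)) (countBelow-digits (digitSet i) (goodDigits (suc i) k) (base∸1 i) R) ⟩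
    (cS * cG) * (2^ k + 2^ k)
      ≡⟨ regroup cS cG (2^ k) ⟩
    (2 * cS) * (cG * 2^ k)
      ≤⟨ ℕₚ.*-mono-≤ (digitSet-half i) (countBelow-goodDigits k (suc i)) ⟩
    base i * R ∎
    where
    open ℕₚ.≤-Reasoning
    R = radix (suc i) k
    cS = countBelow (digitSet i) (base i)
    cG = countBelow (goodDigits (suc i) k) R
    regroup : ∀ a b p → (a * b) * (p + p) ≡ (2 * a) * (b * p)
    regroup = solve-∀

  base∣radix : ∀ k i p → p < k → base (i + p) ∣ radix i k
  base∣radix (suc k) i zero _ = subst (λ j → base j ∣ radix i (suc k)) (sym (ℕₚ.+-identityʳ i)) (m∣m*n (radix (suc i) k))
  base∣radix (suc k) i (suc p) (s≤s p<k) =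
    subst (λ j → base j ∣ radix i (suc k)) (sym (ℕₚ.+-suc i p)) (∣n⇒∣m*n (base i) (base∣radix k (suc i) p p<k))

  radix∣radix : ∀ k m i → radix i k ∣ radix i (k + m)
  radix∣radix zero m i = 1∣ _
  radix∣radix (suc k) m i = *-monoʳ-∣ (base i) (radix∣radix k m (suc i))

  blockLength : ℕ → ℕ
  blockLength K = radix 0 K

  suc∣blockLength : ∀ d K → 2 + d ≤ K → suc d ∣ blockLength K
  suc∣blockLength d K 2+d≤K = ∣-trans (∣-trans (n∣m*n 4) (m∣m*n (4 * suc d))) (base∣radix K 0 (suc d) 2+d≤K)

  blockLength-∣ : ∀ {J K} → J ≤ K → blockLength J ∣ blockLength K
  blockLength-∣ {J} {K} J≤K = subst (λ K → blockLength J ∣ blockLength K) (ℕₚ.m+[n∸m]≡n J≤K) (radix∣radix J (K ∸ J) 0)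

  4∣blockLength : ∀ K → 4 ∣ blockLength (suc K)
  4∣blockLength K = m∣m*n (radix 1 K)

module SparseSet where
  open import Data.Nat using (_+_; _*_; _∸_; _≤_; _<_; _%_)
  open import Data.Nat.DivMod using (%-remove-+ˡ)
  open import Data.Nat.Divisibility using (_∣_; ∣-trans; m∣m*n; _∣0; quotient; m∣n⇒n≡quotient*m)
  open import Data.Nat.Tactic.RingSolver using (solve-∀)
  open Counting
  open MixedRadix

  -- A multiple of blockLength (suc K) beyond 2 (blockStart K + blockLength K) + K: the multiple makes
  -- goodDigits compatible across blocks, the margin leaves a gap in P + P longer than K.
  blockStart : ℕ → ℕ
  blockStart zero = 0
  blockStart (suc K) = blockLength (suc K) * (2 * blockStart K + 2 * blockLength K + suc K)

  blockLength∣blockStart : ∀ K → blockLength K ∣ blockStart K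
  blockLength∣blockStart zero = _ ∣0
  blockLength∣blockStart (suc K) = m∣m*n _

  blockStart-gap : ∀ K → 2 * blockStart K + 2 * blockLength K + suc K ≤ blockStart (suc K)
  blockStart-gap K = ℕₚ.m≤m+n _ (radix∸1 0 (suc K) * _)

  K≤blockStart : ∀ K → K ≤ blockStart K
  K≤blockStart zero = z≤n
  K≤blockStart (suc K) = ℕₚ.≤-trans (ℕₚ.m≤n+m (suc K) _) (blockStart-gap K)

  blockEnd≤blockStart : ∀ K → blockStart K + blockLength K ≤ blockStart (suc K)
  blockEnd≤blockStart K = ℕₚ.≤-trans
    (ℕₚ.+-mono-≤ (ℕₚ.m≤m+n (blockStart K) (blockStart K + 0)) (ℕₚ.m≤m+n (blockLength K) (blockLength K + 0)))
    (ℕₚ.≤-trans (ℕₚ.m≤m+n (2 * blockStart K + 2 * blockLength K) (suc K)) (blockStart-gap K))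

  blockStart-mono : ∀ {j K} → j ≤ K → blockStart j ≤ blockStart K
  blockStart-mono {K = zero} z≤n = z≤n
  blockStart-mono {j} {suc K} j≤K with ℕₚ.m≤n⇒m<n∨m≡n j≤K
  ... | inj₁ (s≤s j≤K') = ℕₚ.≤-trans (blockStart-mono j≤K') (ℕₚ.≤-trans (ℕₚ.m≤m+n _ _) (blockEnd≤blockStart K))
  ... | inj₂ refl = ℕₚ.≤-refl

  blockEnd≤later-blockStart : ∀ {j K} → j < K → blockStart j + blockLength j ≤ blockStart K
  blockEnd≤later-blockStart {j} {suc K} (s≤s j≤K) = ℕₚ.≤-trans (blockEnd-mono j≤K) (blockEnd≤blockStart K)
    where
    blockEnd-mono : ∀ {j K} → j ≤ K → blockStart j + blockLength j ≤ blockStart K + blockLength K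
    blockEnd-mono {K = zero} z≤n = ℕₚ.≤-refl
    blockEnd-mono {j} {suc K} j≤K with ℕₚ.m≤n⇒m<n∨m≡n j≤K
    ... | inj₁ (s≤s j≤K') = ℕₚ.≤-trans (blockEnd-mono j≤K') (ℕₚ.≤-trans (blockEnd≤blockStart K) (ℕₚ.m≤m+n _ _))
    ... | inj₂ refl = ℕₚ.≤-refl

  Sparse : Subset
  Sparse n = ∃[ K ] ∃[ r ] r < blockLength K × goodDigits 0 K r ≡ true × n ≡ blockStart K + r

  Sparse-%4 : ∀ {n} → Sparse n → n % 4 ≤ 1
  Sparse-%4 (zero , zero , _ , _ , refl) = z≤n
  Sparse-%4 (zero , suc r , s≤s () , _ , _)
  Sparse-%4 (suc K , r , _ , good , refl) =
    subst (_≤ 1) (sym (%-remove-+ˡ r (∣-trans (4∣blockLength K) (blockLength∣blockStart (suc K)))))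
    (ℕₚ.≤ᵇ⇒≤ (r % 4) 1 (proj₁ (Equivalence.to Boolₚ.T-∧ (≡true⇒T good))))

  Sparse-block : ∀ {n} → Sparse n → ∃[ j ] blockStart j ≤ n × n < blockStart j + blockLength j
  Sparse-block (j , r , r<M , _ , refl) = j , ℕₚ.m≤m+n (blockStart j) r , ℕₚ.+-monoʳ-< (blockStart j) r<M

  Sparse+Sparse-gap : ∀ K {x y} → Sparse x → Sparse y →
    x + y < 2 * blockStart K + 2 * blockLength K ⊎ blockStart (suc K) ≤ x + y
  Sparse+Sparse-gap K {x} {y} x∈P y∈P with Sparse-block x∈P | Sparse-block y∈P
  ... | j , start≤x , x<end | j' , start≤y , y<end with j ℕₚ.≤? K | j' ℕₚ.≤? K
  ... | yes j≤K | yes j'≤K = inj₁ (ℕₚ.≤-trans (ℕₚ.+-mono-< (below x<end j≤K) (below y<end j'≤K))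
                               (ℕₚ.≤-reflexive (double (blockStart K) (blockLength K))))
    where
    below : ∀ {n j} → n < blockStart j + blockLength j → j ≤ K → n < blockStart K + blockLength K
    below {j = j} n<end j≤K with ℕₚ.m≤n⇒m<n∨m≡n j≤K
    ... | inj₁ j<K = ℕₚ.<-≤-trans n<end (ℕₚ.≤-trans (blockEnd≤later-blockStart j<K) (ℕₚ.m≤m+n _ _))
    ... | inj₂ refl = n<end
    double : ∀ b m → (b + m) + (b + m) ≡ 2 * b + 2 * m
    double = solve-∀
  ... | no j≰K | _ = inj₂ (ℕₚ.≤-trans (blockStart-mono (ℕₚ.≰⇒> j≰K)) (ℕₚ.≤-trans start≤x (ℕₚ.m≤m+n x y)))
  ... | yes _ | no j'≰K = inj₂ (ℕₚ.≤-trans (blockStart-mono (ℕₚ.≰⇒> j'≰K)) (ℕₚ.≤-trans start≤y (ℕₚ.m≤n+m y x)))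

  goodDigits-laterBlock : ∀ {K j} r → K ≤ j → goodDigits 0 j r ≡ true → goodDigits 0 K (r + blockStart j) ≡ true
  goodDigits-laterBlock {K} {j} r K≤j good = begin
    goodDigits 0 K (r + blockStart j)              ≡⟨ cong (λ b → goodDigits 0 K (r + b)) (m∣n⇒n≡quotient*m M∣B) ⟩
    goodDigits 0 K (r + quotient M∣B * blockLength K) ≡⟨ periodic-* (goodDigits-periodic K 0) r (quotient M∣B) ⟩
    goodDigits 0 K r                               ≡⟨ goodDigits-prefix K (j ∸ K) 0 r
                                                        (subst (λ j → goodDigits 0 j r ≡ true) (sym (ℕₚ.m+[n∸m]≡n K≤j)) good) ⟩
    true                                           ∎
    where
    open ≡-Reasoning
    M∣B : blockLength K ∣ blockStart j
    M∣B = ∣-trans (blockLength-∣ K≤j) (blockLength∣blockStart j)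

progression-hits-window : ∀ d G n → 1 ℕ.≤ d → n ℕ.≤ G →
  ∃[ t ] G ℕ.≤ n ℕ.+ t ℕ.* d × n ℕ.+ t ℕ.* d ℕ.< G ℕ.+ d
progression-hits-window d zero zero 1≤d _ = 0 , z≤n , 1≤d
progression-hits-window d (suc G) n 1≤d n≤G+1 with n ℕₚ.≤? G
... | no n≰G = 0 , ℕₚ.≤-trans (ℕₚ.≰⇒> n≰G) (ℕₚ.≤-reflexive (sym (ℕₚ.+-identityʳ n))) ,
    ℕₚ.≤-trans (s≤s (ℕₚ.≤-reflexive (ℕₚ.+-identityʳ n))) (ℕₚ.≤-trans (s≤s n≤G+1)
      (ℕₚ.≤-trans (ℕₚ.≤-reflexive (ℕₚ.+-comm 1 (suc G))) (ℕₚ.+-monoʳ-≤ (suc G) 1≤d)))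
... | yes n≤G with progression-hits-window d G n 1≤d n≤G
...   | t , G≤v , v<G+d with suc G ℕₚ.≤? n ℕ.+ t ℕ.* d
...     | yes G<v = t , G<v , ℕₚ.<-≤-trans v<G+d (ℕₚ.n≤1+n (G ℕ.+ d))
...     | no G≮v = suc t ,
    ℕₚ.≤-trans (ℕₚ.≤-reflexive (ℕₚ.+-comm 1 G)) (ℕₚ.≤-trans (ℕₚ.+-mono-≤ G≤v 1≤d) (ℕₚ.≤-reflexive (step n t d))) ,
    ℕₚ.≤-trans (ℕₚ.≤-reflexive (cong suc (sym (step n t d)))) (s≤s (ℕₚ.+-monoˡ-≤ d (ℕₚ.≤-pred (ℕₚ.≰⇒> G≮v))))
  where
  open import Data.Nat.Tactic.RingSolver using (solve-∀)
  step : ∀ n t d → n ℕ.+ t ℕ.* d ℕ.+ d ≡ n ℕ.+ suc t ℕ.* d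
  step = solve-∀

module Sumset (A₀ : Subset) (A₀⊆4ℕ : ∀ {n} → A₀ n → n ℕ.% 4 ≡ 0) where
  open import Data.Nat using (_+_; _*_; _≤_; _<_; _%_)
  open import Data.Nat.DivMod using (m≡m%n+[m/n]*n; m%n<n; %-distribˡ-+; m%n%n≡m%n; [m+kn]%n≡m%n; m∣n⇒o%n%m≡o%m)
  open import Data.Nat.Divisibility using (_∣_; ∣-trans; n∣m*n; ∣m∣n⇒∣m+n)
  open import Data.Nat.Tactic.RingSolver using (solve-∀)
  open Codes
  open MixedRadix
  open SparseSet

  A : Subset
  A n = A₀ n ⊎ Sparse n

  A-%4 : ∀ {y} → A y → y % 4 ≤ 1
  A-%4 (inj₁ y∈A₀) = ℕₚ.≤-trans (ℕₚ.≤-reflexive (A₀⊆4ℕ y∈A₀)) z≤n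
  A-%4 (inj₂ y∈P) = Sparse-%4 y∈P

  A₀+A-%4 : ∀ {x y} → A₀ x → A y → (x + y) % 4 ≤ 1
  A₀+A-%4 {x} {y} x∈A₀ y∈A = subst (_≤ 1) (sym (begin
    (x + y) % 4               ≡⟨ %-distribˡ-+ x y 4 ⟩
    (x % 4 + y % 4) % 4       ≡⟨ cong (λ r → (r + y % 4) % 4) (A₀⊆4ℕ x∈A₀) ⟩
    y % 4 % 4                 ≡⟨ m%n%n≡m%n y 4 ⟩
    y % 4                     ∎)) (A-%4 y∈A)
    where open ≡-Reasoning

  A⊕A-%4>1 : ∀ {v} → (A ⊕ A) v → ¬ v % 4 ≤ 1 → ∃[ x ] ∃[ y ] Sparse x × Sparse y × x + y ≡ v
  A⊕A-%4>1 (x , y , inj₂ x∈P , inj₂ y∈P , x+y≡v) _ = x , y , x∈P , y∈P , x+y≡v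
  A⊕A-%4>1 (x , y , inj₁ x∈A₀ , y∈A , refl) v%4>1 = ⊥-elim (v%4>1 (A₀+A-%4 x∈A₀ y∈A))
  A⊕A-%4>1 (x , y , x∈A@(inj₂ _) , inj₁ y∈A₀ , refl) v%4>1 =
    ⊥-elim (v%4>1 (subst (λ s → s % 4 ≤ 1) (ℕₚ.+-comm y x) (A₀+A-%4 y∈A₀ x∈A)))

  -- The step is 0 mod 4, and with K = n + step some term falls into the gap [G, G + step) of P + P.
  progression⊆A⊕A⇒%4≤1 : ∀ n d → (∀ t → (A ⊕ A) (n + t * (4 * suc d))) → n % 4 ≤ 1
  progression⊆A⊕A⇒%4≤1 n d AP⊆A⊕A with n % 4 ℕₚ.≤? 1
  ... | yes n%4≤1 = n%4≤1
  ... | no n%4>1 = ⊥-elim (avoids-gap (A⊕A-%4>1 (AP⊆A⊕A t) v%4>1))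
    where
    step = 4 * suc d
    K = n + step
    G = 2 * blockStart K + 2 * blockLength K
    n≤G : n ≤ G
    n≤G = ℕₚ.≤-trans (ℕₚ.m≤m+n n step) (ℕₚ.≤-trans (K≤blockStart K)
            (ℕₚ.≤-trans (ℕₚ.m≤m+n (blockStart K) (blockStart K + 0)) (ℕₚ.m≤m+n (2 * blockStart K) _)))
    window = progression-hits-window step G n (s≤s z≤n) n≤G
    t = proj₁ window
    v = n + t * step
    v%4>1 : ¬ v % 4 ≤ 1
    v%4>1 v%4≤1 = n%4>1 (subst (_≤ 1) v%4≡n%4 v%4≤1)
      where
      v%4≡n%4 : v % 4 ≡ n % 4
      v%4≡n%4 = trans (cong (λ s → (n + s) % 4) (reassoc t (suc d))) ([m+kn]%n≡m%n n (t * suc d) 4)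
        where
        reassoc : ∀ t s → t * (4 * s) ≡ t * s * 4
        reassoc = solve-∀
    G+step≤B : G + step ≤ blockStart (suc K)
    G+step≤B = ℕₚ.≤-trans (ℕₚ.+-monoʳ-≤ G (ℕₚ.≤-trans (ℕₚ.m≤n+m step n) (ℕₚ.n≤1+n K))) (blockStart-gap K)
    avoids-gap : ¬ (∃[ x ] ∃[ y ] Sparse x × Sparse y × x + y ≡ v)
    avoids-gap (x , y , x∈P , y∈P , x+y≡v) with Sparse+Sparse-gap K x∈P y∈P
    ... | inj₁ x+y<G = ℕₚ.<⇒≱ (subst (_< G) x+y≡v x+y<G) (proj₁ (proj₂ window))
    ... | inj₂ B≤x+y = ℕₚ.<⇒≱ (ℕₚ.<-≤-trans (proj₂ (proj₂ window)) G+step≤B) (subst (blockStart (suc K) ≤_) x+y≡v B≤x+y)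

  code⊆A⊕A⇒%4≤1 : ∀ L → ⟦ L ⟧ ⊆ (A ⊕ A) → ∀ {n} → offsetSum L < n → memb L n ≡ true → n % 4 ≤ 1
  code⊆A⊕A⇒%4≤1 L L⊆A⊕A {n} o<n n∈L with period-suc L
  ... | d , period≡ = progression⊆A⊕A⇒%4≤1 n d (λ t →
    L⊆A⊕A _ (trans (memb-+period L (subst (_∣ t * (4 * suc d)) (sym period≡) (∣-trans (n∣m*n 4) (n∣m*n t))) o<n) n∈L))

  -- w = 2 blockStart K + (n mod blockLength K) lies in P + P, and n + 2 blockStart K = w + q blockLength K
  -- where, for K large, the period of L divides both blockStart K and blockLength K.
  A⊕A⊆code⇒%4≤2 : ∀ L → (A ⊕ A) ⊆ ⟦ L ⟧ → ∀ {n} → offsetSum L < n → n % 4 ≤ 2 → memb L n ≡ true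
  A⊕A⊆code⇒%4≤2 L A⊕A⊆L {n} o<n n%4≤2 with period-suc L
  ... | d , period≡ = covered (goodDigits-sum K 0 z (m%n<n n M) z%4≤2)
    where
    K = 2 + d + n
    M = blockLength K
    B = blockStart K
    z = n % M
    q = n ℕ./ M
    z%4≤2 : z % 4 ≤ 2
    z%4≤2 = subst (_≤ 2) (sym (m∣n⇒o%n%m≡o%m 4 M n (4∣blockLength (suc (d + n))))) n%4≤2
    p∣M : period L ∣ M
    p∣M = subst (_∣ M) (sym period≡) (suc∣blockLength d K (ℕₚ.m≤m+n (2 + d) n))
    p∣B+B : period L ∣ B + B
    p∣B+B = ∣m∣n⇒∣m+n p∣B p∣B
      where p∣B = ∣-trans p∣M (blockLength∣blockStart K)
    block : ∀ s → s ≤ z → goodDigits 0 K s ≡ true → Sparse (B + s)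
    block s s≤z good = K , s , ℕₚ.≤-<-trans s≤z (m%n<n n M) , good , refl
    covered : (∃[ r ] ∃[ r' ] goodDigits 0 K r ≡ true × goodDigits 0 K r' ≡ true × r + r' ≡ z) → memb L n ≡ true
    covered (r , r' , r∈G , r'∈G , r+r'≡z) = begin
      memb L n                   ≡⟨ sym (memb-+period L p∣B+B o<n) ⟩
      memb L (n + (B + B))       ≡⟨ cong (memb L) n+2B≡w+qM ⟩
      memb L (w + q * M)         ≡⟨ memb-+period L (∣-trans p∣M (n∣m*n q)) o<w ⟩
      memb L w                   ≡⟨ A⊕A⊆L w (B + r , B + r' , inj₂ (block r r≤z r∈G) , inj₂ (block r' r'≤z r'∈G) , refl) ⟩
      true                       ∎
      where
      open ≡-Reasoning
      w = (B + r) + (B + r')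
      r≤z : r ≤ z
      r≤z = subst (r ≤_) r+r'≡z (ℕₚ.m≤m+n r r')
      r'≤z : r' ≤ z
      r'≤z = subst (r' ≤_) r+r'≡z (ℕₚ.m≤n+m r' r)
      o<w : offsetSum L < w
      o<w = ℕₚ.<-≤-trans o<n (ℕₚ.≤-trans (ℕₚ.m≤n+m n (2 + d)) (ℕₚ.≤-trans (K≤blockStart K)
              (ℕₚ.≤-trans (ℕₚ.m≤m+n B r) (ℕₚ.m≤m+n (B + r) (B + r')))))
      n+2B≡w+qM : n + (B + B) ≡ w + q * M
      n+2B≡w+qM = trans (cong (_+ (B + B)) (m≡m%n+[m/n]*n n M))
        (trans (cong (λ z → z + q * M + (B + B)) (sym r+r'≡z)) (rearrange r r' (q * M) B))
        where
        rearrange : ∀ r r' x B → r + r' + x + (B + B) ≡ (B + r) + (B + r') + x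
        rearrange = solve-∀

  private
    residue≤ : ℕ → ℕ → Bool
    residue≤ k n = n % 4 ℕ.≤ᵇ k

    residue≤-periodic : ∀ k → Counting.Periodic 4 (residue≤ k)
    residue≤-periodic k n = cong (ℕ._≤ᵇ k) ([m+kn]%n≡m%n n 1 4)

  lowerBuck-A⊕A : LowerBuck≤ (A ⊕ A) ½
  lowerBuck-A⊕A L q L⊆A⊕A dL = Densities.density-mono L (periodicCode 3 (residue≤ 1)) (suc (offsetSum L))
    (λ n o<n n∈L → trans (memb-periodicCode (residue≤-periodic 1) n)
      (Counting.≤ᵇ-true (code⊆A⊕A⇒%4≤1 L L⊆A⊕A o<n n∈L)))
    dL (Densities.periodicCode-density (residue≤-periodic 1))

  upperBuck-A⊕A : UpperBuck> (A ⊕ A) ½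
  upperBuck-A⊕A = ℤ.+ 3 / 4 , Fractions.frac-< 1 3 1 3 (s≤s (s≤s (s≤s (s≤s (s≤s z≤n))))) , λ L q A⊕A⊆L dL →
    Densities.density-mono (periodicCode 3 (residue≤ 2)) L (suc (offsetSum L))
      (λ n o<n n∈R → A⊕A⊆code⇒%4≤2 L A⊕A⊆L o<n
        (ℕₚ.≤ᵇ⇒≤ (n % 4) 2 (Counting.≡true⇒T (trans (sym (memb-periodicCode (residue≤-periodic 2) n)) n∈R))))
      (Densities.periodicCode-density (residue≤-periodic 2)) dL

first-crossing : (P : ℕ → Set) → (∀ n → Dec (P n)) → ∀ N → P N → P 0 ⊎ ∃[ b ] b ℕ.< N × ¬ P b × P (suc b)
first-crossing P P? zero P0 = inj₁ P0
first-crossing P P? (suc N) PN+1 with P? N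
... | no ¬PN = inj₂ (N , ℕₚ.n<1+n N , ¬PN , PN+1)
... | yes PN with first-crossing P P? N PN
...   | inj₁ P0 = inj₁ P0
...   | inj₂ (b , b<N , ¬Pb , Pb+1) = inj₂ (b , ℕₚ.m<n⇒m<1+n b<N , ¬Pb , Pb+1)

module Construction (α : ℝ) where
  open ℚ using (_+_; _-_; -_; _≤_; _<_)
  open import Data.Integer using (+_)
  open import Data.Rational.Solver using (module +-*-Solver)
  open +-*-Solver using (solve; _:+_; _:-_; _:=_)
  open import Data.Nat.Tactic.RingSolver using (solve-∀)
  open Fractions
  open Counting
  open Codes
  open Densities
  open BitReversal
  open MixedRadix
  open SparseSet

  patternDensity : ℕ → ℕ → ℚ.ℚ
  patternDensity K a = + a / (2^ K ℕ.* 4)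

  -- 4 · { y : for some k, the dyadic interval [bitReverse k y, bitReverse k y + 1) / 2^ k, which
  --           contains the van der Corput point of y, lies below 4α }
  A₀ : Subset
  A₀ n = n ℕ.% 4 ≡ 0 × ∃[ k ] patternDensity k (suc (bitReverse k (n ℕ./ 4))) q<ʳ α

  open Sumset A₀ proj₁ public

  lowerApprox≤upperApprox : ∀ m n → seq α m - inv m ≤ seq α n + inv n
  lowerApprox≤upperApprox m n = subst (seq α m - inv m ≤_)
    (solve 3 (λ a b c → (a :+ (b :+ c)) :- b := a :+ c) refl (seq α n) (inv m) (inv n))
    (ℚₚ.+-monoˡ-≤ (- inv m) (∣p-q∣≤r⇒p≤q+r (seq α m) (seq α n) (inv m + inv n) (reg α m n)))

  patternDensity-suc : ∀ K b → patternDensity K (suc b) ≤ patternDensity K b + inv K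
  patternDensity-suc K b = frac-≤-+inv (suc b) b (ℕ.pred D) (ℕ.pred D) D K
    (ℕₚ.≤-reflexive (ℕₚ.+-comm D (b ℕ.* D)))
    (ℕₚ.*-monoʳ-≤ D (ℕₚ.≤-trans (n<2^n K) (ℕₚ.m≤m*n (2^ K) 4)))
    where
    D = 2^ K ℕ.* 4

  ¼≤patternDensity-2^ : ∀ K → + 1 / 4 ≤ patternDensity K (2^ K)
  ¼≤patternDensity-2^ K = frac-≤ 1 (2^ K) 3 (ℕ.pred (2^ K ℕ.* 4)) (ℕₚ.≤-reflexive (ℕₚ.*-identityˡ (2^ K ℕ.* 4)))

  innerCode : ℕ → ℕ → Code
  innerCode K a = periodicCode (ℕ.pred (2^ K ℕ.* 4)) (innerPattern K a)

  innerCode-density : ∀ K a → a ℕ.≤ 2^ K → HasDensity (innerCode K a) (patternDensity K a)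
  innerCode-density K a a≤2^K = subst (λ c → HasDensity (innerCode K a) (+ c / (2^ K ℕ.* 4)))
    (countBelow-innerPattern K a a≤2^K) (periodicCode-density (innerPattern-periodic K a))

  innerCode⊆A₀ : ∀ K a m → (0 ℕ.< a → patternDensity K a < seq α m - inv m) → ⟦ innerCode K a ⟧ ⊆ A₀
  innerCode⊆A₀ K a m below n n∈L with innerPattern-true K a n (trans (sym (memb-periodicCode (innerPattern-periodic K a) n)) n∈L)
  ... | n%4≡0 , ρ<a = n%4≡0 , K , m , ℚₚ.≤-<-trans
    (frac-≤ (suc (bitReverse K (n ℕ./ 4))) a (ℕ.pred D) (ℕ.pred D) (ℕₚ.*-monoˡ-≤ D ρ<a)) (below (ℕₚ.≤-<-trans z≤n ρ<a))
    where D = 2^ K ℕ.* 4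

  inner-approximation : α <ʳq (+ 1 / 4) → ∀ q → q q<ʳ α → ∃[ L ] ∃[ q' ] (⟦ L ⟧ ⊆ A × HasDensity L q' × q < q')
  inner-approximation (n₁ , α<¼) q (m , q<ℓ) =
    from-crossing (first-crossing Above (λ a → q ℚₚ.<? patternDensity K a) (2^ K) above-2^K)
    where
    ℓ = seq α m - inv m
    0<ℓ-q : 0ℚ < ℓ - q
    0<ℓ-q = subst (_< ℓ - q) (ℚₚ.+-inverseʳ q) (ℚₚ.+-monoˡ-< (- q) q<ℓ)
    K = proj₁ (inv<pos (ℓ - q) 0<ℓ-q)
    q+inv<ℓ : q + inv K < ℓ
    q+inv<ℓ = subst (q + inv K <_) (solve 2 (λ q ℓ → q :+ (ℓ :- q) := ℓ) refl q ℓ)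
      (ℚₚ.+-monoʳ-< q (proj₂ (inv<pos (ℓ - q) 0<ℓ-q)))
    Above : ℕ → Set
    Above a = q < patternDensity K a
    above-2^K : Above (2^ K)
    above-2^K = ℚₚ.<-≤-trans q<ℓ (ℚₚ.≤-trans (lowerApprox≤upperApprox m n₁)
      (ℚₚ.≤-trans (ℚₚ.<⇒≤ α<¼) (¼≤patternDensity-2^ K)))
    candidate : ∀ a → a ℕ.≤ 2^ K → (0 ℕ.< a → patternDensity K a < ℓ) → Above a →
      ∃[ L ] ∃[ q' ] (⟦ L ⟧ ⊆ A × HasDensity L q' × q < q')
    candidate a a≤2^K below above = innerCode K a , patternDensity K a ,
      (λ n n∈L → inj₁ (innerCode⊆A₀ K a m below n n∈L)) , innerCode-density K a a≤2^K , above
    from-crossing : Above 0 ⊎ ∃[ b ] b ℕ.< 2^ K × ¬ Above b × Above (suc b) →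
      ∃[ L ] ∃[ q' ] (⟦ L ⟧ ⊆ A × HasDensity L q' × q < q')
    from-crossing (inj₁ above-0) = candidate 0 z≤n (λ ()) above-0
    from-crossing (inj₂ (b , b<2^K , ¬above-b , above-b+1)) = candidate (suc b) b<2^K (λ _ → begin-strict
      patternDensity K (suc b)      ≤⟨ patternDensity-suc K b ⟩
      patternDensity K b + inv K    ≤⟨ ℚₚ.+-monoˡ-≤ (inv K) (ℚₚ.≮⇒≥ ¬above-b) ⟩
      q + inv K                     <⟨ q+inv<ℓ ⟩
      ℓ                             ∎) above-b+1
      where open ℚₚ.≤-Reasoning

  outerPattern : ℕ → ℕ → ℕ → Bool
  outerPattern K a n = innerPattern K a n ∨ goodDigits 0 K n

  outerPeriod : ℕ → ℕ
  outerPeriod K = 2^ K ℕ.* 4 ℕ.* blockLength K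

  outerPattern-periodic : ∀ K a → Periodic (outerPeriod K) (outerPattern K a)
  outerPattern-periodic K a n = cong₂ _∨_
    (trans (cong (λ m → innerPattern K a (n ℕ.+ m)) (ℕₚ.*-comm (2^ K ℕ.* 4) (blockLength K)))
      (periodic-* (innerPattern-periodic K a) n (blockLength K)))
    (periodic-* (goodDigits-periodic K 0) n (2^ K ℕ.* 4))

  outerCode : ℕ → ℕ → Code
  outerCode K a = initialSegment (blockStart K) ++ periodicCode (ℕ.pred (outerPeriod K)) (outerPattern K a)

  memb-outerCode : ∀ K a n →
    memb (outerCode K a) n ≡ (memb (initialSegment (blockStart K)) n ∨ (innerPattern K a n ∨ goodDigits 0 K n))
  memb-outerCode K a n = trans (memb-++ (initialSegment (blockStart K)) _ n)
    (cong (memb (initialSegment (blockStart K)) n ∨_) (memb-periodicCode (outerPattern-periodic K a) n))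

  A⊆outerCode : ∀ K a → (∀ n → A₀ n → bitReverse K (n ℕ./ 4) ℕ.< a) → A ⊆ ⟦ outerCode K a ⟧
  A⊆outerCode K a A₀-below n (inj₁ n∈A₀) =
    trans (memb-outerCode K a n) (∨-trueʳ (memb (initialSegment (blockStart K)) n) (∨-trueˡ (goodDigits 0 K n)
      (cong₂ _∧_ (≡ᵇ-true (proj₁ n∈A₀)) (<ᵇ-true (A₀-below n n∈A₀)))))
  A⊆outerCode K a A₀-below _ (inj₂ (j , r , r<M , good , refl)) with K ℕₚ.≤? j
  ... | yes K≤j = trans (memb-outerCode K a x)
    (∨-trueʳ (memb (initialSegment (blockStart K)) x) (∨-trueʳ (innerPattern K a x)
      (trans (cong (goodDigits 0 K) (ℕₚ.+-comm (blockStart j) r)) (goodDigits-laterBlock r K≤j good))))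
    where x = blockStart j ℕ.+ r
  ... | no K≰j = trans (memb-outerCode K a x) (∨-trueˡ (innerPattern K a x ∨ goodDigits 0 K x)
    (memb-initialSegment-< (ℕₚ.<-≤-trans (ℕₚ.+-monoʳ-< (blockStart j) r<M) (blockEnd≤later-blockStart (ℕₚ.≰⇒> K≰j)))))
    where x = blockStart j ℕ.+ r

  outerCode-density : ∀ K a → HasDensity (outerCode K a) (+ countBelow (outerPattern K a) (outerPeriod K) / outerPeriod K)
  outerCode-density K a = eventuallyPeriodic-density (outerCode K a) (ℕ.pred (outerPeriod K)) (outerPattern K a) (blockStart K)
    (outerPattern-periodic K a)
    (λ n B≤n → trans (memb-outerCode K a n) (cong (_∨ outerPattern K a n) (memb-initialSegment-≥ B≤n)))

  outerDensity≤ : ∀ K a → a ℕ.≤ 2^ K →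
    + countBelow (outerPattern K a) (outerPeriod K) / outerPeriod K ≤ patternDensity K a + inv K
  outerDensity≤ K a a≤2^K = frac-≤-+inv c a (ℕ.pred (D ℕ.* M)) (ℕ.pred D) (cG ℕ.* D ℕ.* D) K
    (begin
      c ℕ.* D                              ≤⟨ ℕₚ.*-monoˡ-≤ D c≤ ⟩
      (M ℕ.* a ℕ.+ D ℕ.* cG) ℕ.* D         ≡⟨ expand M a D cG ⟩
      a ℕ.* (D ℕ.* M) ℕ.+ cG ℕ.* D ℕ.* D   ∎)
    (begin
      cG ℕ.* D ℕ.* D ℕ.* suc K             ≡⟨ regroup cG D (suc K) ⟩
      cG ℕ.* suc K ℕ.* (D ℕ.* D)           ≤⟨ ℕₚ.*-monoˡ-≤ (D ℕ.* D) cG-small ⟩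
      M ℕ.* (D ℕ.* D)                      ≡⟨ sym (ℕₚ.*-assoc M D D) ⟩
      M ℕ.* D ℕ.* D                        ≡⟨ cong (ℕ._* D) (ℕₚ.*-comm M D) ⟩
      D ℕ.* M ℕ.* D                        ∎)
    where
    open ℕₚ.≤-Reasoning
    D = 2^ K ℕ.* 4
    M = blockLength K
    c = countBelow (outerPattern K a) (outerPeriod K)
    cG = countBelow (goodDigits 0 K) M
    c≤ : c ℕ.≤ M ℕ.* a ℕ.+ D ℕ.* cG
    c≤ = ℕₚ.≤-trans (countBelow-∨ (innerPattern K a) (goodDigits 0 K) (outerPeriod K)) (ℕₚ.+-mono-≤
      (ℕₚ.≤-reflexive (trans (cong (countBelow (innerPattern K a)) (ℕₚ.*-comm D M))
        (trans (countBelow-periodic (innerPattern-periodic K a) M) (cong (M ℕ.*_) (countBelow-innerPattern K a a≤2^K)))))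
      (ℕₚ.≤-reflexive (countBelow-periodic (goodDigits-periodic K 0) D)))
    cG-small : cG ℕ.* suc K ℕ.≤ M
    cG-small = ℕₚ.≤-trans (ℕₚ.*-monoʳ-≤ cG (n<2^n K)) (countBelow-goodDigits K 0)
    expand : ∀ M a D cG → (M ℕ.* a ℕ.+ D ℕ.* cG) ℕ.* D ≡ a ℕ.* (D ℕ.* M) ℕ.+ cG ℕ.* D ℕ.* D
    expand = solve-∀
    regroup : ∀ cG D s → cG ℕ.* D ℕ.* D ℕ.* s ≡ cG ℕ.* s ℕ.* (D ℕ.* D)
    regroup = solve-∀

  A₀-bitReverse< : ∀ K a w → (∀ m → seq α m - inv m ≤ w) → w ≤ patternDensity K a →
    ∀ n → A₀ n → bitReverse K (n ℕ./ 4) ℕ.< a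
  A₀-bitReverse< K a w below-w w≤ n (_ , k , m , k-interval<αₘ) = ℕₚ.*-cancelʳ-< (2^ k ℕ.* 4) _ a (begin-strict
    bitReverse K y ℕ.* (2^ k ℕ.* 4)          ≡⟨ sym (ℕₚ.*-assoc (bitReverse K y) (2^ k) 4) ⟩
    bitReverse K y ℕ.* 2^ k ℕ.* 4            <⟨ ℕₚ.*-monoˡ-< 4 (bitReverse-dyadic k K y) ⟩
    suc (bitReverse k y) ℕ.* 2^ K ℕ.* 4      ≡⟨ ℕₚ.*-assoc (suc (bitReverse k y)) (2^ K) 4 ⟩
    suc (bitReverse k y) ℕ.* (2^ K ℕ.* 4)    <⟨ frac-<⁻¹ (suc (bitReverse k y)) a (ℕ.pred (2^ k ℕ.* 4)) (ℕ.pred (2^ K ℕ.* 4))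
                                                  (ℚₚ.<-≤-trans k-interval<αₘ (ℚₚ.≤-trans (below-w m) w≤)) ⟩
    a ℕ.* (2^ k ℕ.* 4)                       ∎)
    where
    open ℕₚ.≤-Reasoning
    y = n ℕ./ 4

  outer-approximation : 0ℚ q<ʳ α → α <ʳq (+ 1 / 4) →
    ∀ q → α <ʳq q → ∃[ L ] ∃[ q' ] (A ⊆ ⟦ L ⟧ × HasDensity L q' × q' < q)
  outer-approximation (m₀ , 0<αₘ₀) (n₁ , α<¼) q (n₀ , α<q) = from-upper-bound upper-bound
    where
    UpperBound : Set
    UpperBound = ∃[ w ] w < q × w < + 1 / 4 × (∀ m → seq α m - inv m ≤ w)
    upper-bound : UpperBound
    upper-bound with seq α n₀ + inv n₀ ℚₚ.≤? seq α n₁ + inv n₁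
    ... | yes ≤ = seq α n₀ + inv n₀ , α<q , ℚₚ.≤-<-trans ≤ α<¼ , (λ m → lowerApprox≤upperApprox m n₀)
    ... | no ≰ = seq α n₁ + inv n₁ , ℚₚ.<-trans (ℚₚ.≰⇒> ≰) α<q , α<¼ , (λ m → lowerApprox≤upperApprox m n₁)
    from-upper-bound : UpperBound → ∃[ L ] ∃[ q' ] (A ⊆ ⟦ L ⟧ × HasDensity L q' × q' < q)
    from-upper-bound (w , w<q , w<¼ , below-w) =
      from-crossing (first-crossing Above (λ b → w ℚₚ.≤? patternDensity K b) (2^ K)
        (ℚₚ.≤-trans (ℚₚ.<⇒≤ w<¼) (¼≤patternDensity-2^ K)))
      where
      0<q-w : 0ℚ < q - w
      0<q-w = subst (_< q - w) (ℚₚ.+-inverseʳ w) (ℚₚ.+-monoˡ-< (- w) w<q)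
      j = proj₁ (inv<pos (q - w) 0<q-w)
      K = third j
      i = inv K
      w+inv<q : w + inv j < q
      w+inv<q = subst (w + inv j <_) (solve 2 (λ q w → w :+ (q :- w) := q) refl q w)
        (ℚₚ.+-monoʳ-< w (proj₂ (inv<pos (q - w) 0<q-w)))
      Above : ℕ → Set
      Above b = w ≤ patternDensity K b
      from-crossing : Above 0 ⊎ ∃[ b ] b ℕ.< 2^ K × ¬ Above b × Above (suc b) →
        ∃[ L ] ∃[ q' ] (A ⊆ ⟦ L ⟧ × HasDensity L q' × q' < q)
      from-crossing (inj₁ w≤0) = ⊥-elim (ℚₚ.<-irrefl refl
        (ℚₚ.<-≤-trans (ℚₚ.<-≤-trans 0<αₘ₀ (below-w m₀)) (subst (w ≤_) (ℚₚ.0/n≡0 (2^ K ℕ.* 4)) w≤0)))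
      from-crossing (inj₂ (b , b<2^K , ¬above-b , above-b+1)) =
        outerCode K (suc b) , + countBelow (outerPattern K (suc b)) (outerPeriod K) / outerPeriod K ,
        A⊆outerCode K (suc b) (A₀-bitReverse< K (suc b) w below-w above-b+1) , outerCode-density K (suc b) , (begin-strict
          + countBelow (outerPattern K (suc b)) (outerPeriod K) / outerPeriod K
                                               ≤⟨ outerDensity≤ K (suc b) b<2^K ⟩
          patternDensity K (suc b) + i         ≤⟨ ℚₚ.+-monoˡ-≤ i (patternDensity-suc K b) ⟩
          (patternDensity K b + i) + i         ≤⟨ ℚₚ.+-monoˡ-≤ i (ℚₚ.+-monoˡ-≤ i (ℚₚ.<⇒≤ (ℚₚ.≰⇒> ¬above-b))) ⟩
          (w + i) + i                          ≤⟨ ℚₚ.+-monoʳ-≤ (w + i) (ℚₚ.≤-trans (ℚₚ.≤-reflexive (sym (ℚₚ.+-identityˡ i)))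
                                                    (ℚₚ.+-monoˡ-≤ i (inv-nonneg K))) ⟩
          (w + i) + (i + i)                    ≡⟨ solve 2 (λ w i → (w :+ i) :+ (i :+ i) := w :+ ((i :+ i) :+ i)) refl w i ⟩
          w + ((i + i) + i)                    ≤⟨ ℚₚ.+-monoʳ-≤ w (inv-third j) ⟩
          w + inv j                            <⟨ w+inv<q ⟩
          q                                    ∎)
        where open ℚₚ.≤-Reasoning

  A-buckDensity : 0ℚ q<ʳ α → α <ʳq (+ 1 / 4) → BuckDensity= A α
  A-buckDensity 0<α α<¼ = BuckDensities.buckDensity-intro A α (inner-approximation α<¼) (outer-approximation 0<α α<¼)

open import Data.Integer using (+_)

proposition6p7 : (α : ℝ) → 0ℚ q<ʳ α → α <ʳq (+ 1 / 4) →
    Σ Subset (λ A → BuckDensity= A α × LowerBuck≤ (A ⊕ A) ½ × UpperBuck> (A ⊕ A) ½)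
proposition6p7 α 0<α α<¼ = A , A-buckDensity 0<α α<¼ , lowerBuck-A⊕A , upperBuck-A⊕A
  where open Construction α
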